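{- Let $G$ be a finite abelian group of order $r$ and exponent greater than $2$ with inversion $\iota$. Let $\mathcal{S}$ be the set of inverse-closed subsets of $G$, $\mathcal{S}_1$ the set of $S\in\mathcal{S}$ with $\mathrm{Cay}(G,S)$ connected, non-bipartite and twin-free, and $\mathcal{S}_3'=\{S\in\mathcal{S}_1\mid S^\alpha=S \text{ for some } \alpha\in\mathrm{Hol}(G)-\{1,\iota\}\}$. Then $|\mathcal{S}_3'|/|\mathcal{S}|\le 2^{ -r/24+(\log_2r)^2+\log_2r+2}$.
   Context: $\mathrm{Cay}(G,S)$ has vertex set $G$, $x\sim y$ iff $yx^{ -1}\in S$; twin-free means no two distinct vertices have the same neighbourhood. $\mathrm{Hol}(G)=N_{\mathrm{Sym}(G)}(R(G))=R(G)\rtimes\mathrm{Aut}(G)$, where $R(g)$ is $x\mapsto xg$. -}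

module Defs where

open import Data.Nat using (ℕ; zero; suc; _<_; _≤_; _^_; _*_)
open import Data.Fin using (Fin)
open import Data.Fin.Subset using (Subset; _∈_)
open import Data.Fin.Permutation using (Permutation′; _⟨$⟩ʳ_; _⟨$⟩ˡ_)
open import Data.Bool using (Bool)
open import Data.Product using (Σ; ∃; _×_; _,_)
open import Data.List using (List; length)
open import Data.List.Relation.Unary.Unique.Propositional using (Unique)
open import Data.List.Membership.Propositional using () renaming (_∈_ to _∈ₗ_)
open import Relation.Binary.PropositionalEquality using (_≡_; _≢_)
open import Relation.Binary.Construct.Closure.ReflexiveTransitive using (Star)
open import Relation.Nullary using (¬_)
open import Function using (_⇔_)
open import Algebra.Core using (Op₁; Op₂)
open import Algebra.Structures using (IsAbelianGroup)

-- A finite abelian group of order r, with carrier Fin r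
-- (every finite abelian group of order r is isomorphic to such a one,
-- and all notions below are isomorphism invariant).

record FinAbGroup (r : ℕ) : Set where
  infixl 7 _∙_
  infix 8 _⁻¹
  field
    _∙_ : Op₂ (Fin r)
    ε : Fin r
    _⁻¹ : Op₁ (Fin r)
    isAbelianGroup : IsAbelianGroup _≡_ _∙_ ε _⁻¹

HasCount : {A : Set} → (A → Set) → ℕ → Set
HasCount {A} P n =
  Σ (List A) λ xs → Unique xs × (∀ a → P a ⇔ a ∈ₗ xs) × length xs ≡ n

module _ {r : ℕ} (G : FinAbGroup r) where
  open FinAbGroup G

  pow : Fin r → ℕ → Fin r
  pow g zero = ε
  pow g (suc n) = g ∙ pow g n

  IsExponent : ℕ → Set
  IsExponent e = 0 < e × (∀ g → pow g e ≡ ε)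
                 × (∀ m → 0 < m → (∀ g → pow g m ≡ ε) → e ≤ m)

  InverseClosed : Subset r → Set
  InverseClosed S = ∀ x → x ∈ S → x ⁻¹ ∈ S

  Adj : Subset r → Fin r → Fin r → Set
  Adj S x y = (y ∙ x ⁻¹) ∈ S

  Connected : Subset r → Set
  Connected S = ∀ x y → Star (Adj S) x y

  Bipartite : Subset r → Set
  Bipartite S = Σ (Fin r → Bool) λ c → ∀ x y → Adj S x y → c x ≢ c y

  TwinFree : Subset r → Set
  TwinFree S = ∀ x y → (∀ z → Adj S x z ⇔ Adj S y z) → x ≡ y

  R : Fin r → Fin r → Fin r
  R g x = x ∙ g

  -- π ∈ Hol(G) = N_{Sym(G)}(R(G)):  π R(G) π⁻¹ = R(G)
  InHol : Permutation′ r → Set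
  InHol π =
    (∀ g → ∃ λ h → ∀ x → π ⟨$⟩ʳ (R g (π ⟨$⟩ˡ x)) ≡ R h x) ×
    (∀ h → ∃ λ g → ∀ x → π ⟨$⟩ʳ (R g (π ⟨$⟩ˡ x)) ≡ R h x)

  Fixes : Permutation′ r → Subset r → Set
  Fixes α S = ∀ y → (∃ λ s → s ∈ S × α ⟨$⟩ʳ s ≡ y) ⇔ y ∈ S

  NotIdOrInv : Permutation′ r → Set
  NotIdOrInv α = ¬ (∀ x → α ⟨$⟩ʳ x ≡ x) × ¬ (∀ x → α ⟨$⟩ʳ x ≡ x ⁻¹)

  InS₁ : Subset r → Set
  InS₁ S = InverseClosed S × Connected S × ¬ Bipartite S × TwinFree S

  InS₃′ : Subset r → Set
  InS₃′ S = InS₁ S × ∃ λ α → InHol α × NotIdOrInv α × Fixes α S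

-- The real-number bound  n₃ / n ≤ 2^(-r/24 + (log₂ r)² + log₂ r + 2),
-- written exactly in natural-number arithmetic.
-- With L = log₂ r (so 2^L = r), and taking 24th powers, it is
--     A ≤ B · 2^(24 L²),  A = n₃^24 · 2^r,  B = 4^24 · n^24 · r^24,
-- i.e. log₂(A/B) ≤ 24 L².  By density of ℚ (and 24L² ≥ 0) this holds iff
-- every nonnegative rational p/q below log₂(A/B) is below 24 L².

-- p/q < log₂ (a/b)     (q ≥ 1, b ≥ 1)
RatBelowLog₂ : ℕ → ℕ → ℕ → ℕ → Set
RatBelowLog₂ p q a b = 2 ^ p * b ^ q < a ^ q

-- p/q < 24 (log₂ r)²  iff  some rational m/k ≥ 0 has m/k < log₂ r
-- (i.e. 2^m < r^k) and (m/k)² > p/(24 q)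
RatBelow24Log₂Sq : ℕ → ℕ → ℕ → Set
RatBelow24Log₂Sq p q r =
  ∃ λ m → ∃ λ k → 0 < k × 2 ^ m < r ^ k × p * (k * k) < 24 * q * (m * m)

Bound : (r n n₃ : ℕ) → Set
Bound r n n₃ =
  ∀ p q → 0 < q →
    RatBelowLog₂ p q (n₃ ^ 24 * 2 ^ r) (4 ^ 24 * n ^ 24 * r ^ 24) →
    RatBelow24Log₂Sq p q r

-- Every α ∈ Hol(G) is affine, α x = ψ x · a₀ with ψ ∈ Aut(G). If α fixes a twin-free inverse-closed S,
-- then ψ ≠ 1 and ψ ≠ ι (otherwise S would be invariant under the translation by a₀, so a₀ = 1 and α ∈ {1, ι}).
-- The points fixed by α and the points inverted by α then form proper cosets (or are empty), and counting
-- translates shows that at least r/6 points x have α x ∉ {x, x⁻¹}. Among the u representatives of the pairs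
-- {x, x⁻¹}, at least r/24 are therefore determined by the membership of other, strictly smaller,
-- representatives. So S is determined by a₀, by ψ on an independent generating set of k ≤ log₂ r elements,
-- and by at most u - r/24 bits, whereas the inverse-closed sets number 2^u:
-- |𝒮₃′| / |𝒮| ≤ r^(1+k) 2^(-r/24).

module Submission where

open import Defs
open import Algebra.Bundles using (AbelianGroup)
open import Algebra.Core using (Op₁; Op₂)
import Algebra.Properties.AbelianGroup as AbelianGroupProperties
import Algebra.Properties.CommutativeSemigroup as CommutativeSemigroupProperties
open import Algebra.Structures using (IsAbelianGroup)
open import Data.Bool using (Bool; true; false; not; _∧_; _∨_; if_then_else_) renaming (_≟_ to _≟ᵇ_)
open import Data.Bool.Properties
  using (∨-zeroʳ; ∧-zeroʳ; ∧-identityʳ; ∧-conicalˡ; ∧-conicalʳ; ∧-comm; ∧-idem; not-¬; ⇔→≡)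
open import Data.Empty using (⊥-elim)
open import Data.Fin using (Fin; zero; suc; toℕ; fromℕ<; _≟_; combine; funToFin; finToFun)
open import Data.Fin.Permutation using (Permutation′; _⟨$⟩ʳ_; _⟨$⟩ˡ_)
import Data.Fin.Permutation as Permutation
open import Data.Fin.Properties
  using (toℕ-injective; toℕ<n; toℕ-fromℕ<; any?; all?; ¬∀⟶∃¬; combine-injective;
         funToFin-finToFin; finToFun-funToFin; injective⇒≤; 2↔Bool)
open import Data.Fin.Subset using (Subset; _∈_)
open import Data.List using (List; []; _∷_; length; allFin)
import Data.List as List
open import Data.List.Membership.Propositional using () renaming (_∈_ to _∈ₗ_)
open import Data.List.Membership.Propositional.Properties using (∈-lookup; ∈-allFin)
import Data.List.Relation.Unary.All as All
open import Data.List.Relation.Unary.AllPairs using (_∷_)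
open import Data.List.Relation.Unary.Any using (here; there; index)
open import Data.List.Relation.Unary.Any.Properties using (lookup-index)
open import Data.List.Relation.Unary.Unique.Propositional using (Unique)
open import Data.Nat using (ℕ; zero; suc; _+_; _*_; _∸_; _^_; _/_; _%_; _≤_; _<_; z≤n; s≤s; >-nonZero; _≤?_; _<?_)
  renaming (_≟_ to _ℕ≟_)
open import Data.Nat.DivMod using (m≡m%n+[m/n]*n; m%n<n; m<n*o⇒m/o<n)
open import Data.Nat.Induction using (<-wellFounded)
open import Data.Nat.Properties hiding (_≟_)
open import Algebra.Properties.CommutativeMonoid.Sum +-0-commutativeMonoid using (sum-permute)
open import Algebra.Properties.Monoid.Sum +-0-monoid using (sum)
open import Data.Nat.Solver using (module +-*-Solver)
open import Data.Product using (Σ; ∃; _×_; _,_; proj₁; proj₂)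
open import Data.Sum using (_⊎_; inj₁; inj₂)
open import Data.Unit using (⊤; tt)
open import Data.Vec using (Vec; []; _∷_; lookup; map; head; tail; tabulate; fromList)
open import Data.Vec.Properties using (map-∘; tabulate-cong; tabulate∘lookup; lookup∘tabulate; []=⇒lookup; lookup⇒[]=)
open import Function using (_∘_; _↔_; _⇔_; mk⇔; Inverse; Injective; Equivalence)
open import Function.Properties.Inverse using (↔-sym; ↔-refl)
open import Induction.WellFounded using (Acc; acc)
open import Relation.Binary.PropositionalEquality
  using (_≡_; _≢_; refl; sym; trans; cong; cong₂; subst; module ≡-Reasoning)
open import Relation.Nullary using (¬_; yes; no; Dec; does)
open import Relation.Nullary.Decidable using (True; toWitness; dec-true; dec-false; ¬?; _×-dec_)

does-true⇒ : ∀ {A : Set} (a? : Dec A) → does a? ≡ true → A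
does-true⇒ (yes a) _ = a

does-false⇒ : ∀ {A : Set} (a? : Dec A) → does a? ≡ false → ¬ A
does-false⇒ (no ¬a) _ = ¬a

module Counting where

  indicator : Bool → ℕ
  indicator b = if b then 1 else 0

  count : ∀ {n} → (Fin n → Bool) → ℕ
  count p = sum (indicator ∘ p)

  count-cong : ∀ {n} {p q : Fin n → Bool} → (∀ x → p x ≡ q x) → count p ≡ count q
  count-cong {zero} eq = refl
  count-cong {suc n} eq = cong₂ _+_ (cong indicator (eq zero)) (count-cong (eq ∘ suc))

  count-≤ : ∀ {n} (p : Fin n → Bool) → count p ≤ n
  count-≤ {zero} p = z≤n
  count-≤ {suc n} p with p zero
  ... | true = s≤s (count-≤ (p ∘ suc))
  ... | false = m≤n⇒m≤1+n (count-≤ (p ∘ suc))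

  count-mono : ∀ {n} {p q : Fin n → Bool} → (∀ x → p x ≡ true → q x ≡ true) → count p ≤ count q
  count-mono {zero} p⇒q = z≤n
  count-mono {suc n} {p} {q} p⇒q with p zero | q zero | p⇒q zero
  ... | true | true | _ = s≤s (count-mono (p⇒q ∘ suc))
  ... | true | false | p⇒q₀ with () ← p⇒q₀ refl
  ... | false | true | _ = m≤n⇒m≤1+n (count-mono (p⇒q ∘ suc))
  ... | false | false | _ = count-mono (p⇒q ∘ suc)

  count-false : ∀ {n} {p : Fin n → Bool} → (∀ x → p x ≡ false) → count p ≡ 0
  count-false {zero} eq = refl
  count-false {suc n} eq rewrite eq zero = count-false (eq ∘ suc)

  count-true : ∀ {n} {p : Fin n → Bool} → (∀ x → p x ≡ true) → count p ≡ n
  count-true {zero} eq = refl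
  count-true {suc n} eq rewrite eq zero = cong suc (count-true (eq ∘ suc))

  count-inclusion-exclusion : ∀ {n} (p q : Fin n → Bool) →
    count (λ x → p x ∨ q x) + count (λ x → p x ∧ q x) ≡ count p + count q
  count-inclusion-exclusion {zero} p q = refl
  count-inclusion-exclusion {suc n} p q =
    trans (ℕ-interchange (indicator (p zero ∨ q zero)) _ (indicator (p zero ∧ q zero)) _)
      (trans (cong₂ _+_ (pointwise (p zero) (q zero)) (count-inclusion-exclusion (p ∘ suc) (q ∘ suc)))
        (ℕ-interchange (indicator (p zero)) (indicator (q zero)) _ _))
    where
    open CommutativeSemigroupProperties +-commutativeSemigroup using () renaming (interchange to ℕ-interchange)
    pointwise : ∀ a b → indicator (a ∨ b) + indicator (a ∧ b) ≡ indicator a + indicator b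
    pointwise true true = refl
    pointwise true false = refl
    pointwise false true = refl
    pointwise false false = refl

  count-disjoint-∨ : ∀ {n} (p q : Fin n → Bool) → (∀ x → p x ≡ true → q x ≡ false) →
    count (λ x → p x ∨ q x) ≡ count p + count q
  count-disjoint-∨ p q disjoint = begin
    count (λ x → p x ∨ q x)                            ≡⟨ sym (+-identityʳ _) ⟩
    count (λ x → p x ∨ q x) + 0                        ≡⟨ cong (V +_) (sym (count-false p∧q≡false)) ⟩
    count (λ x → p x ∨ q x) + count (λ x → p x ∧ q x)  ≡⟨ count-inclusion-exclusion p q ⟩
    count p + count q                                  ∎
    where
    open ≡-Reasoning
    V = count (λ x → p x ∨ q x)
    p∧q≡false : ∀ x → (p x ∧ q x) ≡ false
    p∧q≡false x with p x in px
    ... | true = disjoint x px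
    ... | false = refl

  count-split : ∀ {n} (p q : Fin n → Bool) →
    count (λ x → p x ∧ q x) + count (λ x → p x ∧ not (q x)) ≡ count p
  count-split {zero} p q = refl
  count-split {suc n} p q with p zero | q zero
  ... | true | true = cong suc (count-split (p ∘ suc) (q ∘ suc))
  ... | true | false = trans (+-suc _ _) (cong suc (count-split (p ∘ suc) (q ∘ suc)))
  ... | false | _ = count-split (p ∘ suc) (q ∘ suc)

  count-complement : ∀ {n} (p : Fin n → Bool) → count p + count (not ∘ p) ≡ n
  count-complement {zero} p = refl
  count-complement {suc n} p with p zero
  ... | true = cong suc (count-complement (p ∘ suc))
  ... | false = trans (+-suc _ _) (cong suc (count-complement (p ∘ suc)))

  count-permute : ∀ {n} (p : Fin n → Bool) (π : Permutation′ n) → count (p ∘ (π ⟨$⟩ʳ_)) ≡ count p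
  count-permute p π = sym (sum-permute (indicator ∘ p) π)

  count-nonzero⇒∃ : ∀ {n} (p : Fin n → Bool) → 0 < count p → ∃ λ x → p x ≡ true
  count-nonzero⇒∃ {suc n} p pos with p zero in p₀
  ... | true = zero , p₀
  ... | false = let x , px = count-nonzero⇒∃ (p ∘ suc) pos in suc x , px

  module _ {A : Set} where

    elements : ∀ {n} (p : Fin n → Bool) → Vec (Fin n) (count p)
    elements-step : ∀ {n} (b : Bool) (p : Fin n → Bool) → Vec (Fin (suc n)) (indicator b + count p)
    elements {zero} p = []
    elements {suc n} p = elements-step (p zero) (p ∘ suc)
    elements-step true p = zero ∷ map suc (elements p)
    elements-step false p = map suc (elements p)

    extend : ∀ {n} (p : Fin n → Bool) → A → Vec A (count p) → Fin n → A
    extend-step : ∀ {n} (b : Bool) (p : Fin n → Bool) → A → Vec A (indicator b + count p) → Fin (suc n) → A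
    extend {suc n} p = extend-step (p zero) (p ∘ suc)
    extend-step true p d (a ∷ v) zero = a
    extend-step true p d (a ∷ v) (suc x) = extend p d v x
    extend-step false p d v zero = d
    extend-step false p d v (suc x) = extend p d v x

    restrict : ∀ {n} (p : Fin n → Bool) → (Fin n → A) → Vec A (count p)
    restrict p s = map s (elements p)

    restrict-suc : ∀ {n} (p : Fin n → Bool) (s : Fin (suc n) → A) →
      map s (map suc (elements p)) ≡ restrict p (s ∘ suc)
    restrict-suc p s = sym (map-∘ s suc (elements p))

    restrict-injective : ∀ {n} (p : Fin n → Bool) {s₁ s₂ : Fin n → A} →
      restrict p s₁ ≡ restrict p s₂ → ∀ x → p x ≡ true → s₁ x ≡ s₂ x
    restrict-injective {suc n} p eq zero px with p zero
    ... | true = cong head eq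
    restrict-injective {suc n} p eq zero () | false
    restrict-injective {suc n} p {s₁} {s₂} eq (suc x) px with p zero
    ... | true = restrict-injective (p ∘ suc)
      (trans (sym (restrict-suc (p ∘ suc) s₁)) (trans (cong tail eq) (restrict-suc (p ∘ suc) s₂))) x px
    ... | false = restrict-injective (p ∘ suc)
      (trans (sym (restrict-suc (p ∘ suc) s₁)) (trans eq (restrict-suc (p ∘ suc) s₂))) x px

    restrict-extend : ∀ {n} (p : Fin n → Bool) (d : A) (v : Vec A (count p)) (s : Fin n → A) →
      (∀ x → p x ≡ true → s x ≡ extend p d v x) → restrict p s ≡ v
    restrict-extend {zero} p d [] s agree = refl
    restrict-extend {suc n} p d v s agree = step (p zero) v (agree zero) (agree ∘ suc)
      where
      step : ∀ b (v : Vec A (indicator b + count (p ∘ suc))) →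
        (b ≡ true → s zero ≡ extend-step b (p ∘ suc) d v zero) →
        (∀ x → p (suc x) ≡ true → s (suc x) ≡ extend-step b (p ∘ suc) d v (suc x)) →
        map s (elements-step b (p ∘ suc)) ≡ v
      step true (a ∷ v) agree₀ agreeₛ = cong₂ _∷_ (agree₀ refl)
        (trans (restrict-suc (p ∘ suc) s) (restrict-extend (p ∘ suc) d v (s ∘ suc) agreeₛ))
      step false v agree₀ agreeₛ =
        trans (restrict-suc (p ∘ suc) s) (restrict-extend (p ∘ suc) d v (s ∘ suc) agreeₛ)

module Cardinality where

  funToFin-cong : ∀ {k m} {f g : Fin k → Fin m} → (∀ i → f i ≡ g i) → funToFin f ≡ funToFin g
  funToFin-cong {zero} eq = refl
  funToFin-cong {suc k} eq = cong₂ combine (eq zero) (funToFin-cong (eq ∘ suc))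

  module VecCoding {A : Set} {m : ℕ} (A↔Fin : A ↔ Fin m) where
    open Inverse A↔Fin using (to; from; strictlyInverseˡ; strictlyInverseʳ)

    encode : ∀ {k} → Vec A k → Fin (m ^ k)
    encode v = funToFin (to ∘ lookup v)

    decode : ∀ k → Fin (m ^ k) → Vec A k
    decode k i = tabulate (from ∘ finToFun i)

    decode∘encode : ∀ {k} (v : Vec A k) → decode k (encode v) ≡ v
    decode∘encode v = trans
      (tabulate-cong λ i → trans (cong from (finToFun-funToFin (to ∘ lookup v) i)) (strictlyInverseʳ (lookup v i)))
      (tabulate∘lookup v)

    encode∘decode : ∀ k (i : Fin (m ^ k)) → encode (decode k i) ≡ i
    encode∘decode k i = trans
      (funToFin-cong λ j → trans (cong to (lookup∘tabulate _ j)) (strictlyInverseˡ (finToFun {m} {k} i j)))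
      (funToFin-finToFin {k} i)

    encode-injective : ∀ {k} → Injective _≡_ _≡_ (encode {k})
    encode-injective {k} {u} {v} eq = trans (sym (decode∘encode u)) (trans (cong (decode k) eq) (decode∘encode v))

    decode-injective : ∀ k → Injective _≡_ _≡_ (decode k)
    decode-injective k {i} {j} eq = trans (sym (encode∘decode k i)) (trans (cong encode eq) (encode∘decode k j))

  module _ {A : Set} where

    -- Truncates vectors longer than n.
    pad : ∀ {m} n → A → Vec A m → Vec A n
    pad zero a _ = []
    pad (suc n) a [] = a ∷ pad n a []
    pad (suc n) a (x ∷ xs) = x ∷ pad n a xs

    pad-injective : ∀ {m n} (a : A) {xs ys : Vec A m} → m ≤ n → pad n a xs ≡ pad n a ys → xs ≡ ys
    pad-injective a {[]} {[]} _ _ = refl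
    pad-injective a {x ∷ xs} {y ∷ ys} (s≤s m≤n) eq = cong₂ _∷_ (cong head eq) (pad-injective a m≤n (cong tail eq))

  lookup-injective : ∀ {A : Set} {xs : List.List A} → Unique xs → ∀ i j → List.lookup xs i ≡ List.lookup xs j → i ≡ j
  lookup-injective (_ ∷ _) zero zero _ = refl
  lookup-injective (x∉xs ∷ _) zero (suc j) eq = ⊥-elim (All.lookup x∉xs (∈-lookup j) eq)
  lookup-injective (x∉xs ∷ _) (suc i) zero eq = ⊥-elim (All.lookup x∉xs (∈-lookup i) (sym eq))
  lookup-injective (_ ∷ unique) (suc i) (suc j) eq = cong suc (lookup-injective unique i j eq)

  module _ {A : Set} {P : A → Set} where

    ≤-HasCount : ∀ {m n} → HasCount P n → (f : Fin m → A) → (∀ i → P (f i)) → Injective _≡_ _≡_ f → m ≤ n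
    ≤-HasCount (xs , _ , P⇔∈ , refl) f Pf f-injective = injective⇒≤ {f = position} λ eq →
      f-injective (trans (lookup-index (∈xs _)) (trans (cong (List.lookup xs) eq) (sym (lookup-index (∈xs _)))))
      where
      ∈xs : ∀ i → f i ∈ₗ xs
      ∈xs i = Equivalence.to (P⇔∈ (f i)) (Pf i)
      position : Fin _ → Fin (List.length xs)
      position i = index (∈xs i)

    HasCount-≤ : ∀ {m n} → HasCount P n → (code : ∀ a → P a → Fin m) →
      (∀ {a b} pa pb → code a pa ≡ code b pb → a ≡ b) → n ≤ m
    HasCount-≤ (xs , unique , P⇔∈ , refl) code code-injective =
      injective⇒≤ {f = λ i → code (List.lookup xs i) (P-lookup i)} λ {i} {j} eq →
        lookup-injective unique i j (code-injective (P-lookup i) (P-lookup j) eq)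
      where
      P-lookup : ∀ i → P (List.lookup xs i)
      P-lookup i = Equivalence.from (P⇔∈ _) (∈-lookup i)

module Arithmetic where


  open +-*-Solver

  ^-distribʳ-* : ∀ m n k → (m * n) ^ k ≡ m ^ k * n ^ k
  ^-distribʳ-* m n zero = refl
  ^-distribʳ-* m n (suc k) = trans (cong (m * n *_) (^-distribʳ-* m n k))
    (solve 4 (λ m n a b → m :* n :* (a :* b) := m :* a :* (n :* b)) refl m n (m ^ k) (n ^ k))

  code-size-estimate : ∀ e {r n n₃ k M u} → n₃ ≤ r * (r ^ k * 2 ^ M) → 2 ^ u ≤ n → e * M + r ≤ e * u →
    n₃ ^ e * 2 ^ r ≤ n ^ e * r ^ e * r ^ (e * k)
  code-size-estimate e {r} {n} {n₃} {k} {M} {u} n₃≤ 2^u≤n M-small = begin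
    n₃ ^ e * 2 ^ r                                 ≤⟨ *-monoˡ-≤ (2 ^ r) (^-monoˡ-≤ e n₃≤) ⟩
    (r * (r ^ k * 2 ^ M)) ^ e * 2 ^ r               ≡⟨ cong (_* 2 ^ r) expand ⟩
    r ^ e * (r ^ (e * k) * 2 ^ (e * M)) * 2 ^ r     ≡⟨ solve 4 (λ a b c d → a :* (b :* c) :* d := a :* b :* (c :* d))
                                                          refl (r ^ e) (r ^ (e * k)) (2 ^ (e * M)) (2 ^ r) ⟩
    r ^ e * r ^ (e * k) * (2 ^ (e * M) * 2 ^ r)     ≡⟨ cong (r ^ e * r ^ (e * k) *_) (sym (^-distribˡ-+-* 2 (e * M) r)) ⟩
    r ^ e * r ^ (e * k) * 2 ^ (e * M + r)           ≤⟨ *-monoʳ-≤ (r ^ e * r ^ (e * k)) (^-monoʳ-≤ 2 M-small) ⟩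
    r ^ e * r ^ (e * k) * 2 ^ (e * u)               ≡⟨ cong (r ^ e * r ^ (e * k) *_) (^-*-assoc′ 2 u e) ⟩
    r ^ e * r ^ (e * k) * (2 ^ u) ^ e               ≤⟨ *-monoʳ-≤ (r ^ e * r ^ (e * k)) (^-monoˡ-≤ e 2^u≤n) ⟩
    r ^ e * r ^ (e * k) * n ^ e                     ≡⟨ solve 3 (λ a b c → a :* b :* c := c :* a :* b)
                                                          refl (r ^ e) (r ^ (e * k)) (n ^ e) ⟩
    n ^ e * r ^ e * r ^ (e * k)                     ∎
    where
    open ≤-Reasoning
    ^-*-assoc′ : ∀ a b c → a ^ (c * b) ≡ (a ^ b) ^ c
    ^-*-assoc′ a b c = trans (cong (a ^_) (*-comm c b)) (sym (^-*-assoc a b c))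
    expand : (r * (r ^ k * 2 ^ M)) ^ e ≡ r ^ e * (r ^ (e * k) * 2 ^ (e * M))
    expand = begin-equality
      (r * (r ^ k * 2 ^ M)) ^ e              ≡⟨ ^-distribʳ-* r (r ^ k * 2 ^ M) e ⟩
      r ^ e * (r ^ k * 2 ^ M) ^ e            ≡⟨ cong (r ^ e *_) (^-distribʳ-* (r ^ k) (2 ^ M) e) ⟩
      r ^ e * ((r ^ k) ^ e * (2 ^ M) ^ e)    ≡⟨ cong (r ^ e *_) (sym (cong₂ _*_ (^-*-assoc′ r k e) (^-*-assoc′ 2 M e))) ⟩
      r ^ e * (r ^ (e * k) * 2 ^ (e * M))    ∎

  RatBelowLog₂-rescale : ∀ {c} m p q {A B R} → c ≡ 2 ^ m → c * A ≤ B * R → RatBelowLog₂ p q A B →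
    2 ^ (p + m * q) < R ^ q
  RatBelowLog₂-rescale {c} m p q {A} {B} {R} c≡2^m cA≤BR p/q<log = *-cancelʳ-< (B ^ q) _ _ (begin-strict
    2 ^ (p + m * q) * B ^ q        ≡⟨ cong (_* B ^ q) (^-distribˡ-+-* 2 p (m * q)) ⟩
    2 ^ p * 2 ^ (m * q) * B ^ q    ≡⟨ solve 3 (λ a b d → a :* b :* d := b :* (a :* d)) refl (2 ^ p) (2 ^ (m * q)) (B ^ q) ⟩
    2 ^ (m * q) * (2 ^ p * B ^ q)  <⟨ *-monoʳ-< (2 ^ (m * q)) {{>-nonZero (m^n>0 2 (m * q))}} p/q<log ⟩
    2 ^ (m * q) * A ^ q            ≡⟨ cong (_* A ^ q) (sym (trans (cong (_^ q) c≡2^m) (^-*-assoc 2 m q))) ⟩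
    c ^ q * A ^ q                  ≡⟨ sym (^-distribʳ-* c A q) ⟩
    (c * A) ^ q                    ≤⟨ ^-monoˡ-≤ q cA≤BR ⟩
    (B * R) ^ q                    ≡⟨ ^-distribʳ-* B R q ⟩
    B ^ q * R ^ q                  ≡⟨ *-comm (B ^ q) (R ^ q) ⟩
    R ^ q * B ^ q                  ∎)
    where open ≤-Reasoning

  square-bound : ∀ p q J → p + 48 * q < 24 * suc J * q → p * suc J < 24 * q * (J * J)
  square-bound p q J lt = ≤-<-trans (m≤m+n (p * suc J) (24 * q)) (+-cancelʳ-< (24 * q * J) _ _ (begin-strict
      p * suc J + 24 * q + 24 * q * J  ≡⟨ solve 3 (λ p q j → p :* (con 1 :+ j) :+ con 24 :* q :+ con 24 :* q :* j
                                                        := (p :+ con 24 :* q) :* (con 1 :+ j)) refl p q J ⟩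
      (p + 24 * q) * suc J             <⟨ *-monoˡ-< (suc J) lt′ ⟩
      24 * q * J * suc J               ≡⟨ solve 2 (λ q j → con 24 :* q :* j :* (con 1 :+ j)
                                                        := con 24 :* q :* (j :* j) :+ con 24 :* q :* j) refl q J ⟩
      24 * q * (J * J) + 24 * q * J    ∎))
    where
    open ≤-Reasoning
    lt′ : p + 24 * q < 24 * q * J
    lt′ = +-cancelʳ-< (24 * q) _ _ (begin-strict
      p + 24 * q + 24 * q   ≡⟨ solve 2 (λ p q → p :+ con 24 :* q :+ con 24 :* q := p :+ con 48 :* q) refl p q ⟩
      p + 48 * q            <⟨ lt ⟩
      24 * suc J * q        ≡⟨ solve 2 (λ q j → con 24 :* (con 1 :+ j) :* q := con 24 :* q :* j :+ con 24 :* q) refl q J ⟩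
      24 * q * J + 24 * q   ∎)

  -- Here (p + 48 q)/(24 k q) < log₂ r and k ≤ log₂ r; the rational witness is that fraction
  -- when it is at least k, and (k² - 1)/k otherwise.
  RatBelow24Log₂Sq-intro : ∀ p q {r} k → 0 < q → 2 ^ k ≤ r → 2 ^ (p + 48 * q) < r ^ (24 * k * q) →
    RatBelow24Log₂Sq p q r
  RatBelow24Log₂Sq-intro p q zero _ _ lt = ⊥-elim (<⇒≱ lt (m^n>0 2 (p + 48 * q)))
  RatBelow24Log₂Sq-intro p (suc q′) {r} k@(suc k′) _ 2^k≤r lt with 24 * k * k * suc q′ ≤? p + 48 * suc q′
  ... | yes large = m , 24 * k * q , s≤s z≤n , lt , (begin-strict
      p * (24 * k * q * (24 * k * q))  ≡⟨ solve 3 (λ p k q → p :* (con 24 :* k :* q :* (con 24 :* k :* q))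
                                                       := con 24 :* q :* (p :* (con 24 :* k :* k :* q))) refl p k q ⟩
      24 * q * (p * (24 * k * k * q))  ≤⟨ *-monoʳ-≤ (24 * q) (*-monoʳ-≤ p large) ⟩
      24 * q * (p * m)                 <⟨ *-monoʳ-< (24 * q) (*-monoˡ-< m {{>-nonZero (≤-<-trans z≤n p<m)}} p<m) ⟩
      24 * q * (m * m)                 ∎)
    where
    open ≤-Reasoning
    q = suc q′
    m = p + 48 * q
    p<m : p < m
    p<m = m<m+n p (s≤s z≤n)
  ... | no small = J , k , s≤s z≤n , 2^J<r^k ,
        square-bound p q J (subst (p + 48 * q <_) k*k≡suc-J (≰⇒> small))
    where
    open ≤-Reasoning
    q = suc q′
    J = k′ + k′ * k
    k*k≡suc-J : 24 * k * k * q ≡ 24 * suc J * q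
    k*k≡suc-J = solve 2 (λ k′ q′ → con 24 :* (con 1 :+ k′) :* (con 1 :+ k′) :* (con 1 :+ q′)
      := con 24 :* (con 1 :+ (k′ :+ k′ :* (con 1 :+ k′))) :* (con 1 :+ q′)) refl k′ q′
    2^J<r^k : 2 ^ J < r ^ k
    2^J<r^k = begin-strict
      2 ^ J         <⟨ m<m+n (2 ^ J) (≤-trans (m^n>0 2 J) (m≤m+n _ 0)) ⟩
      2 ^ (k * k)   ≡⟨ sym (^-*-assoc 2 k k) ⟩
      (2 ^ k) ^ k   ≤⟨ ^-monoˡ-≤ k 2^k≤r ⟩
      r ^ k         ∎

  ⌈_/24⌉ : ℕ → ℕ
  ⌈ m /24⌉ = (m + 23) / 24

  m≤24*⌈m/24⌉ : ∀ m → m ≤ 24 * ⌈ m /24⌉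
  m≤24*⌈m/24⌉ m = +-cancelʳ-≤ 23 m (24 * ⌈ m /24⌉) (begin
    m + 23                                 ≡⟨ m≡m%n+[m/n]*n (m + 23) 24 ⟩
    (m + 23) % 24 + ⌈ m /24⌉ * 24          ≤⟨ +-monoˡ-≤ (⌈ m /24⌉ * 24) (≤-pred (m%n<n (m + 23) 24)) ⟩
    23 + ⌈ m /24⌉ * 24                     ≡⟨ trans (+-comm 23 _) (cong (_+ 23) (*-comm ⌈ m /24⌉ 24)) ⟩
    24 * ⌈ m /24⌉ + 23                     ∎)
    where open ≤-Reasoning

  ⌈m/24⌉-least : ∀ {m d} → m ≤ 24 * d → ⌈ m /24⌉ ≤ d
  ⌈m/24⌉-least {m} {d} m≤24d = ≤-pred (m<n*o⇒m/o<n {m + 23} {suc d} {24} (begin-strict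
    m + 23           ≤⟨ +-monoˡ-≤ 23 m≤24d ⟩
    24 * d + 23      <⟨ +-monoʳ-< (24 * d) ≤-refl ⟩
    24 * d + 24      ≡⟨ trans (+-comm (24 * d) 24) (trans (sym (*-suc 24 d)) (*-comm 24 (suc d))) ⟩
    suc d * 24       ∎))
    where open ≤-Reasoning

  Bound-intro : ∀ {r n n₃} k M u → n₃ ≤ r * (r ^ k * 2 ^ M) → 2 ^ u ≤ n → 2 ^ k ≤ r → 24 * M + r ≤ 24 * u →
    Bound r n n₃
  Bound-intro {r} {n} {n₃} k M u n₃≤ 2^u≤n 2^k≤r M-small p q q>0 p/q<log =
    RatBelow24Log₂Sq-intro p q k q>0 2^k≤r (subst (2 ^ (p + 48 * q) <_) (^-*-assoc r (24 * k) q)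
      (RatBelowLog₂-rescale 48 p q (^-*-assoc 2 2 24) (estimate (4 ^ 24)) p/q<log))
    where
    -- The constant is kept abstract: unfolding 4 ^ 24 * x would unary-expand the numeral.
    estimate : ∀ c → c * (n₃ ^ 24 * 2 ^ r) ≤ c * n ^ 24 * r ^ 24 * r ^ (24 * k)
    estimate c = begin
      c * (n₃ ^ 24 * 2 ^ r)
        ≤⟨ *-monoʳ-≤ c (code-size-estimate 24 {r} {n} {n₃} {k} {M} {u} n₃≤ 2^u≤n M-small) ⟩
      c * (n ^ 24 * r ^ 24 * r ^ (24 * k))   ≡⟨ solve 4 (λ c a b d → c :* (a :* b :* d) := c :* a :* b :* d)
                                                   refl c (n ^ 24) (r ^ 24) (r ^ (24 * k)) ⟩
      c * n ^ 24 * r ^ 24 * r ^ (24 * k)     ∎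
      where open ≤-Reasoning

-- solve n (λ { (x ∷ y ∷ …) → lhs ⊜ rhs }) ρ  proves lhs = rhs at ρ whenever both sides have the same exponent
-- vectors, i.e. whenever the equation holds in all abelian groups; this side condition is decided by evaluation.
module AbelianGroupSolver {A : Set} {_·_ : Op₂ A} {e : A} {inv : Op₁ A}
                          (isAbelianGroup : IsAbelianGroup _≡_ _·_ e inv) where

  group : AbelianGroup _ _
  group = record { Carrier = A ; _≈_ = _≡_ ; _∙_ = _·_ ; ε = e ; _⁻¹ = inv ; isAbelianGroup = isAbelianGroup }

  open AbelianGroup group using (_∙_; ε; _⁻¹; assoc; comm; identityˡ; identityʳ; inverseʳ; commutativeSemigroup)
  open AbelianGroupProperties group using (⁻¹-∙-comm; ⁻¹-involutive; ε⁻¹≈ε)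
  open CommutativeSemigroupProperties commutativeSemigroup using (interchange)

  infixl 6 _⊕_
  infix 7 ⊝_
  infix 4 _⊜_

  data Expr (n : ℕ) : Set where
    var : Fin n → Expr n
    unit : Expr n
    _⊕_ : Expr n → Expr n → Expr n
    ⊝_ : Expr n → Expr n

  _⊜_ : ∀ {n} → Expr n → Expr n → Expr n × Expr n
  a ⊜ b = a , b

  ⟦_⟧ : ∀ {n} → Expr n → Vec A n → A
  ⟦ var i ⟧ ρ = lookup ρ i
  ⟦ unit ⟧ ρ = ε
  ⟦ a ⊕ b ⟧ ρ = ⟦ a ⟧ ρ ∙ ⟦ b ⟧ ρ
  ⟦ ⊝ a ⟧ ρ = ⟦ a ⟧ ρ ⁻¹

  power : A → ℕ → A
  power x zero = ε
  power x (suc k) = x ∙ power x k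

  product : ∀ {n} → Vec A n → (Fin n → ℕ) → A
  product [] e = ε
  product (x ∷ ρ) e = power x (e zero) ∙ product ρ (e ∘ suc)

  indicatorAt : ∀ {n} → Fin n → Fin n → ℕ
  indicatorAt zero zero = 1
  indicatorAt zero (suc j) = 0
  indicatorAt (suc i) zero = 0
  indicatorAt (suc i) (suc j) = indicatorAt i j

  positive negative : ∀ {n} → Expr n → Fin n → ℕ
  positive (var i) = indicatorAt i
  positive unit _ = 0
  positive (a ⊕ b) j = positive a j + positive b j
  positive (⊝ a) = negative a
  negative (var i) _ = 0
  negative unit _ = 0
  negative (a ⊕ b) j = negative a j + negative b j
  negative (⊝ a) = positive a

  power-+ : ∀ x m n → power x (m + n) ≡ power x m ∙ power x n
  power-+ x zero n = sym (identityˡ _)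
  power-+ x (suc m) n = trans (cong (x ∙_) (power-+ x m n)) (sym (assoc _ _ _))

  product-cong : ∀ {n} (ρ : Vec A n) {e f : Fin n → ℕ} → (∀ i → e i ≡ f i) → product ρ e ≡ product ρ f
  product-cong [] eq = refl
  product-cong (x ∷ ρ) eq = cong₂ _∙_ (cong (power x) (eq zero)) (product-cong ρ (eq ∘ suc))

  product-+ : ∀ {n} (ρ : Vec A n) (e f : Fin n → ℕ) → product ρ (λ i → e i + f i) ≡ product ρ e ∙ product ρ f
  product-+ [] e f = sym (identityˡ _)
  product-+ (x ∷ ρ) e f = trans (cong₂ _∙_ (power-+ x (e zero) (f zero)) (product-+ ρ (e ∘ suc) (f ∘ suc)))
    (interchange _ _ _ _)

  product-0 : ∀ {n} (ρ : Vec A n) → product ρ (λ _ → 0) ≡ ε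
  product-0 [] = refl
  product-0 (x ∷ ρ) = trans (identityˡ _) (product-0 ρ)

  product-indicatorAt : ∀ {n} (ρ : Vec A n) i → product ρ (indicatorAt i) ≡ lookup ρ i
  product-indicatorAt (x ∷ ρ) zero = trans (cong₂ _∙_ (identityʳ x) (product-0 ρ)) (identityʳ x)
  product-indicatorAt (x ∷ ρ) (suc i) = trans (identityˡ _) (product-indicatorAt ρ i)

  normalForm : ∀ {n} → Expr n → Vec A n → A
  normalForm a ρ = product ρ (positive a) ∙ product ρ (negative a) ⁻¹

  ⟦⟧≡normalForm : ∀ {n} (a : Expr n) ρ → ⟦ a ⟧ ρ ≡ normalForm a ρ
  ⟦⟧≡normalForm (var i) ρ = sym (trans (cong₂ _∙_ (product-indicatorAt ρ i) (trans (cong _⁻¹ (product-0 ρ)) ε⁻¹≈ε))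
    (identityʳ _))
  ⟦⟧≡normalForm unit ρ =
    sym (trans (cong₂ _∙_ (product-0 ρ) (trans (cong _⁻¹ (product-0 ρ)) ε⁻¹≈ε)) (identityʳ ε))
  ⟦⟧≡normalForm (a ⊕ b) ρ = begin
    ⟦ a ⟧ ρ ∙ ⟦ b ⟧ ρ                        ≡⟨ cong₂ _∙_ (⟦⟧≡normalForm a ρ) (⟦⟧≡normalForm b ρ) ⟩
    (Pa ∙ Na ⁻¹) ∙ (Pb ∙ Nb ⁻¹)              ≡⟨ interchange Pa (Na ⁻¹) Pb (Nb ⁻¹) ⟩
    (Pa ∙ Pb) ∙ (Na ⁻¹ ∙ Nb ⁻¹)              ≡⟨ cong₂ _∙_ (sym (product-+ ρ _ _)) (⁻¹-∙-comm Na Nb) ⟩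
    product ρ (positive (a ⊕ b)) ∙ (Na ∙ Nb) ⁻¹
      ≡⟨ cong (λ x → product ρ (positive (a ⊕ b)) ∙ x ⁻¹) (sym (product-+ ρ _ _)) ⟩
    normalForm (a ⊕ b) ρ                     ∎
    where
    open ≡-Reasoning
    Pa = product ρ (positive a)
    Na = product ρ (negative a)
    Pb = product ρ (positive b)
    Nb = product ρ (negative b)
  ⟦⟧≡normalForm (⊝ a) ρ = begin
    ⟦ a ⟧ ρ ⁻¹                ≡⟨ cong _⁻¹ (⟦⟧≡normalForm a ρ) ⟩
    (Pa ∙ Na ⁻¹) ⁻¹           ≡⟨ sym (⁻¹-∙-comm Pa (Na ⁻¹)) ⟩
    Pa ⁻¹ ∙ Na ⁻¹ ⁻¹          ≡⟨ cong (Pa ⁻¹ ∙_) (⁻¹-involutive Na) ⟩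
    Pa ⁻¹ ∙ Na                ≡⟨ comm (Pa ⁻¹) Na ⟩
    Na ∙ Pa ⁻¹                ∎
    where
    open ≡-Reasoning
    Pa = product ρ (positive a)
    Na = product ρ (negative a)

  quotient-extend : ∀ x y z → x ∙ y ⁻¹ ≡ (x ∙ z) ∙ (y ∙ z) ⁻¹
  quotient-extend x y z = sym (begin
    (x ∙ z) ∙ (y ∙ z) ⁻¹          ≡⟨ cong ((x ∙ z) ∙_) (sym (⁻¹-∙-comm y z)) ⟩
    (x ∙ z) ∙ (y ⁻¹ ∙ z ⁻¹)       ≡⟨ interchange x z (y ⁻¹) (z ⁻¹) ⟩
    (x ∙ y ⁻¹) ∙ (z ∙ z ⁻¹)       ≡⟨ cong ((x ∙ y ⁻¹) ∙_) (inverseʳ z) ⟩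
    (x ∙ y ⁻¹) ∙ ε                ≡⟨ identityʳ _ ⟩
    x ∙ y ⁻¹                      ∎)
    where open ≡-Reasoning

  SameNormalForm : ∀ {n} → Expr n → Expr n → Set
  SameNormalForm a b = ∀ i → positive a i + negative b i ≡ positive b i + negative a i

  normalForm-cong : ∀ {n} (a b : Expr n) ρ → SameNormalForm a b → normalForm a ρ ≡ normalForm b ρ
  normalForm-cong a b ρ same = begin
    Pa ∙ Na ⁻¹                    ≡⟨ quotient-extend Pa Na Nb ⟩
    (Pa ∙ Nb) ∙ (Na ∙ Nb) ⁻¹      ≡⟨ cong₂ (λ x y → x ∙ y ⁻¹) cross (comm Na Nb) ⟩
    (Pb ∙ Na) ∙ (Nb ∙ Na) ⁻¹      ≡⟨ sym (quotient-extend Pb Nb Na) ⟩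
    Pb ∙ Nb ⁻¹                    ∎
    where
    open ≡-Reasoning
    Pa = product ρ (positive a)
    Na = product ρ (negative a)
    Pb = product ρ (positive b)
    Nb = product ρ (negative b)
    cross : Pa ∙ Nb ≡ Pb ∙ Na
    cross = trans (sym (product-+ ρ _ _)) (trans (product-cong ρ same) (product-+ ρ _ _))

  solve : ∀ n (equation : Vec (Expr n) n → Expr n × Expr n) (ρ : Vec A n) →
    let (a , b) = equation (tabulate var) in
    {True (all? λ i → positive a i + negative b i ℕ≟ positive b i + negative a i)} → ⟦ a ⟧ ρ ≡ ⟦ b ⟧ ρ
  solve n equation ρ {same} = let (a , b) = equation (tabulate var) in
    trans (⟦⟧≡normalForm a ρ) (trans (normalForm-cong a b ρ (toWitness same)) (sym (⟦⟧≡normalForm b ρ)))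

module FinAbGroupProperties {r : ℕ} (G : FinAbGroup r) where

  open FinAbGroup G public
  open IsAbelianGroup isAbelianGroup public using (assoc; comm; identityˡ; identityʳ; inverseʳ)
  open AbelianGroupSolver isAbelianGroup public using (solve; _⊕_; ⊝_; _⊜_; unit; group)
  open AbelianGroupProperties group public
    using (⁻¹-involutive; ⁻¹-∙-comm; ∙-cancelˡ; ε⁻¹≈ε; inverseʳ-unique)
  open CommutativeSemigroupProperties (AbelianGroup.commutativeSemigroup group) public using (interchange)

  ⁻¹-distrib-∙ : ∀ x y → (x ∙ y) ⁻¹ ≡ x ⁻¹ ∙ y ⁻¹
  ⁻¹-distrib-∙ x y = sym (⁻¹-∙-comm x y)

  shift : Fin r → Permutation′ r
  shift t = Permutation.permutation (_∙ t) (_∙ t ⁻¹)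
    (λ x → solve 2 (λ { (x ∷ t ∷ []) → x ⊕ ⊝ t ⊕ t ⊜ x }) (x ∷ t ∷ []))
    (λ x → solve 2 (λ { (x ∷ t ∷ []) → x ⊕ t ⊕ ⊝ t ⊜ x }) (x ∷ t ∷ []))

  inversion : Permutation′ r
  inversion = Permutation.permutation _⁻¹ _⁻¹ ⁻¹-involutive ⁻¹-involutive

  pow-+ : ∀ g m n → pow G g (m + n) ≡ pow G g m ∙ pow G g n
  pow-+ g zero n = sym (identityˡ _)
  pow-+ g (suc m) n = trans (cong (g ∙_) (pow-+ g m n)) (sym (assoc _ _ _))

  IsHomomorphism : (Fin r → Fin r) → Set
  IsHomomorphism ψ = ∀ x y → ψ (x ∙ y) ≡ ψ x ∙ ψ y

  module Homomorphism {ψ : Fin r → Fin r} (ψ-hom : IsHomomorphism ψ) where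

    ψ-ε : ψ ε ≡ ε
    ψ-ε = ∙-cancelˡ (ψ ε) _ _ (trans (sym (ψ-hom ε ε)) (trans (cong ψ (identityˡ ε)) (sym (identityʳ _))))

    ψ-⁻¹ : ∀ x → ψ (x ⁻¹) ≡ ψ x ⁻¹
    ψ-⁻¹ x = inverseʳ-unique (ψ x) _ (trans (sym (ψ-hom x (x ⁻¹))) (trans (cong ψ (inverseʳ x)) ψ-ε))

    ψ-pow : ∀ g c → ψ (pow G g c) ≡ pow G (ψ g) c
    ψ-pow g zero = ψ-ε
    ψ-pow g (suc c) = trans (ψ-hom g (pow G g c)) (cong (ψ g ∙_) (ψ-pow g c))

module Generators {r : ℕ} (G : FinAbGroup r) (e′ : ℕ) (pow-exponent : ∀ g → pow G g (suc e′) ≡ FinAbGroup.ε G) where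

  open FinAbGroupProperties G

  e : ℕ
  e = suc e′

  pow-multiple : ∀ g c → pow G g (c * e) ≡ ε
  pow-multiple g zero = refl
  pow-multiple g (suc c) = trans (pow-+ g e (c * e)) (trans (cong₂ _∙_ (pow-exponent g) (pow-multiple g c)) (identityˡ ε))

  pow-inverse : ∀ g c → pow G g (c * e′) ≡ pow G g c ⁻¹
  pow-inverse g c = inverseʳ-unique (pow G g c) _
    (trans (sym (pow-+ g c (c * e′))) (trans (cong (pow G g) (sym (*-suc c e′))) (pow-multiple g c)))

  pow-% : ∀ g c → pow G g (c % e) ≡ pow G g c
  pow-% g c = sym (begin
    pow G g c                                ≡⟨ cong (pow G g) (m≡m%n+[m/n]*n c e) ⟩
    pow G g (c % e + c / e * e)              ≡⟨ pow-+ g (c % e) _ ⟩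
    pow G g (c % e) ∙ pow G g (c / e * e)    ≡⟨ cong (pow G g (c % e) ∙_) (pow-multiple g (c / e)) ⟩
    pow G g (c % e) ∙ ε                      ≡⟨ identityʳ _ ⟩
    pow G g (c % e)                          ∎)
    where open ≡-Reasoning

  InSpan : List (Fin r) → Fin r → Set
  InSpan [] x = x ≡ ε
  InSpan (g ∷ gs) x = Σ ℕ λ c → Σ (Fin r) λ y → InSpan gs y × x ≡ pow G g c ∙ y

  span-ε : ∀ gs → InSpan gs ε
  span-ε [] = refl
  span-ε (g ∷ gs) = 0 , ε , span-ε gs , sym (identityˡ ε)

  span-∙ : ∀ gs {x y} → InSpan gs x → InSpan gs y → InSpan gs (x ∙ y)
  span-∙ [] refl refl = identityˡ ε
  span-∙ (g ∷ gs) (c , u , u∈ , refl) (d , v , v∈ , refl) =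
    c + d , u ∙ v , span-∙ gs u∈ v∈ , trans (interchange _ _ _ _) (cong (_∙ (u ∙ v)) (sym (pow-+ g c d)))

  span-⁻¹ : ∀ gs {x} → InSpan gs x → InSpan gs (x ⁻¹)
  span-⁻¹ [] refl = ε⁻¹≈ε
  span-⁻¹ (g ∷ gs) (c , u , u∈ , refl) =
    c * e′ , u ⁻¹ , span-⁻¹ gs u∈ , trans (⁻¹-distrib-∙ _ _) (cong (_∙ (u ⁻¹)) (sym (pow-inverse g c)))

  span-∷ : ∀ g gs {x} → InSpan gs x → InSpan (g ∷ gs) x
  span-∷ g gs {x} x∈ = 0 , x , x∈ , sym (identityˡ x)

  span? : ∀ gs x → Dec (InSpan gs x)
  span? [] x = x ≟ ε
  span? (g ∷ gs) x with any? {n = e} (λ i → span? gs (x ∙ pow G g (toℕ i) ⁻¹))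
  ... | yes (i , y∈) =
    yes (toℕ i , _ , y∈ , solve 2 (λ { (x ∷ h ∷ []) → x ⊜ h ⊕ (x ⊕ ⊝ h) }) (x ∷ pow G g (toℕ i) ∷ []))
  ... | no ∉ = no λ (c , y , y∈ , x≡) → ∉ (fromℕ< (m%n<n c e) , subst (InSpan gs) (y≡ c y x≡) y∈)
    where
    y≡ : ∀ c y → x ≡ pow G g c ∙ y → y ≡ x ∙ pow G g (toℕ (fromℕ< (m%n<n c e))) ⁻¹
    y≡ c y x≡ = trans (solve 2 (λ { (y ∷ h ∷ []) → y ⊜ h ⊕ y ⊕ ⊝ h }) (y ∷ pow G g c ∷ []))
      (cong₂ (λ a b → a ∙ b ⁻¹) (sym x≡) (trans (sym (pow-% g c)) (cong (pow G g) (sym (toℕ-fromℕ< (m%n<n c e))))))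

  Independent : List (Fin r) → Set
  Independent [] = ⊤
  Independent (g ∷ gs) = ¬ InSpan gs g × Independent gs

  addIndependent : List (Fin r) → List (Fin r) → List (Fin r)
  addIndependent gs [] = gs
  addIndependent gs (x ∷ xs) with span? gs x
  ... | yes _ = addIndependent gs xs
  ... | no _ = addIndependent (x ∷ gs) xs

  addIndependent-independent : ∀ gs xs → Independent gs → Independent (addIndependent gs xs)
  addIndependent-independent gs [] ind = ind
  addIndependent-independent gs (x ∷ xs) ind with span? gs x
  ... | yes _ = addIndependent-independent gs xs ind
  ... | no x∉ = addIndependent-independent (x ∷ gs) xs (x∉ , ind)

  addIndependent-⊇ : ∀ gs xs {y} → InSpan gs y → InSpan (addIndependent gs xs) y
  addIndependent-⊇ gs [] y∈ = y∈
  addIndependent-⊇ gs (x ∷ xs) y∈ with span? gs x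
  ... | yes _ = addIndependent-⊇ gs xs y∈
  ... | no _ = addIndependent-⊇ (x ∷ gs) xs (span-∷ x gs y∈)

  addIndependent-spans : ∀ gs xs {y} → y ∈ₗ xs → InSpan (addIndependent gs xs) y
  addIndependent-spans gs (x ∷ xs) (here refl) with span? gs x
  ... | yes x∈ = addIndependent-⊇ gs xs x∈
  ... | no _ = addIndependent-⊇ (x ∷ gs) xs (1 , ε , span-ε gs , sym (trans (identityʳ _) (identityʳ _)))
  addIndependent-spans gs (x ∷ xs) (there y∈) with span? gs x
  ... | yes _ = addIndependent-spans gs xs y∈
  ... | no _ = addIndependent-spans (x ∷ gs) xs y∈

  gens : List (Fin r)
  gens = addIndependent [] (allFin r)

  #gens : ℕ
  #gens = length gens

  gens-span : ∀ x → InSpan gens x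
  gens-span x = addIndependent-spans [] (allFin r) (∈-allFin x)

  gens-independent : Independent gens
  gens-independent = addIndependent-independent [] (allFin r) tt

  subsetProduct : ∀ (gs : List (Fin r)) → Vec Bool (length gs) → Fin r
  subsetProduct [] [] = ε
  subsetProduct (g ∷ gs) (b ∷ bs) = (if b then g else ε) ∙ subsetProduct gs bs

  subsetProduct-span : ∀ gs bs → InSpan gs (subsetProduct gs bs)
  subsetProduct-span [] [] = refl
  subsetProduct-span (g ∷ gs) (true ∷ bs) = 1 , _ , subsetProduct-span gs bs , cong (_∙ _) (sym (identityʳ g))
  subsetProduct-span (g ∷ gs) (false ∷ bs) = 0 , _ , subsetProduct-span gs bs , refl

  span-quotient : ∀ gs {g x y} → InSpan gs x → InSpan gs y → g ∙ x ≡ y → InSpan gs g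
  span-quotient gs {g} {x} x∈ y∈ g∙x≡y = subst (InSpan gs)
    (trans (cong (_∙ x ⁻¹) (sym g∙x≡y)) (solve 2 (λ { (g ∷ x ∷ []) → g ⊕ x ⊕ ⊝ x ⊜ g }) (g ∷ x ∷ [])))
    (span-∙ gs y∈ (span-⁻¹ gs x∈))

  subsetProduct-injective : ∀ gs → Independent gs → ∀ u v → subsetProduct gs u ≡ subsetProduct gs v → u ≡ v
  subsetProduct-injective [] _ [] [] _ = refl
  subsetProduct-injective (g ∷ gs) (_ , ind) (true ∷ u) (true ∷ v) eq =
    cong (true ∷_) (subsetProduct-injective gs ind u v (∙-cancelˡ g _ _ eq))
  subsetProduct-injective (g ∷ gs) (_ , ind) (false ∷ u) (false ∷ v) eq =
    cong (false ∷_) (subsetProduct-injective gs ind u v (∙-cancelˡ ε _ _ eq))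
  subsetProduct-injective (g ∷ gs) (g∉ , _) (true ∷ u) (false ∷ v) eq = ⊥-elim (g∉
    (span-quotient gs (subsetProduct-span gs u) (subsetProduct-span gs v) (trans eq (identityˡ _))))
  subsetProduct-injective (g ∷ gs) (g∉ , _) (false ∷ u) (true ∷ v) eq = ⊥-elim (g∉
    (span-quotient gs (subsetProduct-span gs v) (subsetProduct-span gs u) (trans (sym eq) (identityˡ _))))

  2^#gens≤r : 2 ^ #gens ≤ r
  2^#gens≤r = injective⇒≤ {f = product-of-code} λ {i} {j} eq →
    decode-injective #gens (subsetProduct-injective gens gens-independent (decode #gens i) (decode #gens j) eq)
    where
    open Cardinality.VecCoding (↔-sym 2↔Bool)
    product-of-code : Fin (2 ^ #gens) → Fin r
    product-of-code i = subsetProduct gens (decode #gens i)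

  imageOf : ∀ gs → Vec (Fin r) (length gs) → ∀ {x} → InSpan gs x → Fin r
  imageOf [] [] _ = ε
  imageOf (g ∷ gs) (h ∷ hs) (c , _ , y∈ , _) = pow G h c ∙ imageOf gs hs y∈

  imageOf-homomorphism : ∀ {ψ} → IsHomomorphism ψ → ∀ gs {x} (x∈ : InSpan gs x) →
    imageOf gs (map ψ (fromList gs)) x∈ ≡ ψ x
  imageOf-homomorphism ψ-hom [] refl = sym ψ-ε
    where open Homomorphism ψ-hom
  imageOf-homomorphism {ψ} ψ-hom (g ∷ gs) (c , y , y∈ , refl) =
    trans (cong₂ _∙_ (sym (ψ-pow g c)) (imageOf-homomorphism ψ-hom gs y∈)) (sym (ψ-hom _ _))
    where open Homomorphism ψ-hom

  homomorphismFromImages : Vec (Fin r) #gens → Fin r → Fin r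
  homomorphismFromImages hs x = imageOf gens hs (gens-span x)

  homomorphismFromImages-correct : ∀ {ψ} → IsHomomorphism ψ → ∀ x → homomorphismFromImages (map ψ (fromList gens)) x ≡ ψ x
  homomorphismFromImages-correct ψ-hom x = imageOf-homomorphism ψ-hom gens (gens-span x)

module AffineSubsets {r : ℕ} (G : FinAbGroup r) where

  open FinAbGroupProperties G
  open Counting

  count-shift : ∀ P t → count (λ y → P (y ∙ t)) ≡ count P
  count-shift P t = count-permute P (shift t)

  IsAffine : (Fin r → Bool) → Set
  IsAffine P = ∀ x y z → P x ≡ true → P y ≡ true → P z ≡ true → P (x ∙ y ⁻¹ ∙ z) ≡ true

  DisjointFromShift : (Fin r → Bool) → Fin r → Set
  DisjointFromShift P a = ∀ x → P x ≡ true → P (x ∙ a) ≡ false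

  module _ {P : Fin r → Bool} {a : Fin r} (disjoint : DisjointFromShift P a) where

    disjoint⁻¹ : ∀ x → P x ≡ true → P (x ∙ a ⁻¹) ≡ false
    disjoint⁻¹ x px with P (x ∙ a ⁻¹) in pxa
    ... | false = refl
    ... | true = trans (sym px)
      (trans (cong P (solve 2 (λ { (x ∷ a ∷ []) → x ⊜ x ⊕ ⊝ a ⊕ a }) (x ∷ a ∷ []))) (disjoint _ pxa))

    count-∨-shift : count (λ y → P y ∨ P (y ∙ a ⁻¹)) ≡ count P + count P
    count-∨-shift = trans (count-disjoint-∨ P _ disjoint⁻¹) (cong (count P +_) (count-shift P (a ⁻¹)))

    count+count≤r : count P + count P ≤ r
    count+count≤r = subst (_≤ r) count-∨-shift (count-≤ _)

    module _ (affine : IsAffine P) {x₀ : Fin r} (px₀ : P x₀ ≡ true) where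

      affine-at : ∀ {x y z w} → P x ≡ true → P y ≡ true → P z ≡ true → x ∙ y ⁻¹ ∙ z ≡ w → P w ≡ true
      affine-at px py pz refl = affine _ _ _ px py pz

      -- Otherwise P, P·a and P·(x₀⁻¹ y) would be three disjoint translates of P.
      covers : r < 3 * count P → ∀ y → (P y ∨ P (y ∙ a ⁻¹)) ≡ true
      covers large y with P y in py | P (y ∙ a ⁻¹) in pya
      ... | true | _ = refl
      ... | false | true = refl
      ... | false | false = ⊥-elim (<⇒≱ large three-copies)
        where
        t = x₀ ⁻¹ ∙ y
        Q : Fin r → Bool
        Q w = P (w ∙ t ⁻¹)
        Q-disjoint : ∀ w → (P w ∨ P (w ∙ a ⁻¹)) ≡ true → Q w ≡ false
        Q-disjoint w _ with Q w in qw | P w in pw | P (w ∙ a ⁻¹) in pwa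
        ... | false | _ | _ = refl
        ... | true | true | _ with () ← trans (sym (affine-at px₀ qw pw
              (solve 3 (λ { (x₀ ∷ w ∷ y ∷ []) → x₀ ⊕ ⊝ (w ⊕ ⊝ (⊝ x₀ ⊕ y)) ⊕ w ⊜ y })
                (x₀ ∷ w ∷ y ∷ [])))) py
        ... | true | false | true with () ← trans (sym (affine-at px₀ qw pwa
              (solve 4 (λ { (x₀ ∷ w ∷ y ∷ a ∷ []) →
                              x₀ ⊕ ⊝ (w ⊕ ⊝ (⊝ x₀ ⊕ y)) ⊕ (w ⊕ ⊝ a) ⊜ y ⊕ ⊝ a })
                (x₀ ∷ w ∷ y ∷ a ∷ [])))) pya
        three-copies : 3 * count P ≤ r
        three-copies = subst (_≤ r) (begin
          count (λ w → (P w ∨ P (w ∙ a ⁻¹)) ∨ Q w)  ≡⟨ count-disjoint-∨ _ Q Q-disjoint ⟩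
          count (λ w → P w ∨ P (w ∙ a ⁻¹)) + count Q ≡⟨ cong₂ _+_ count-∨-shift (count-shift P (t ⁻¹)) ⟩
          count P + count P + count P                ≡⟨ triple (count P) ⟩
          3 * count P                                ∎) (count-≤ _)
          where
          open ≡-Reasoning
          triple : ∀ c → c + c + c ≡ 3 * c
          triple c = trans (+-assoc c c c) (cong (λ x → c + (c + x)) (sym (+-identityʳ c)))

      module _ (cover : ∀ y → (P y ∨ P (y ∙ a ⁻¹)) ≡ true) where

        outside⇒shift-inside : ∀ w → P w ≡ false → P (w ∙ a ⁻¹) ≡ true
        outside⇒shift-inside w pw = subst (λ b → (b ∨ P (w ∙ a ⁻¹)) ≡ true) pw (cover w)

        -- P is a coset of an index-2 subgroup, so each translation either preserves or complements it.
        shift-law : ∀ t y → P (y ∙ t) ≡ (if P (x₀ ∙ t) then P y else not (P y))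
        shift-law t y with P (x₀ ∙ t) in px₀t | P y in py | P (y ∙ t) in pyt
        ... | true | true | true = refl
        ... | true | false | false = refl
        ... | false | true | false = refl
        ... | false | false | true = refl
        ... | true | true | false with () ← trans (sym (affine-at px₀t px₀ py
              (solve 3 (λ { (x₀ ∷ t ∷ y ∷ []) → x₀ ⊕ t ⊕ ⊝ x₀ ⊕ y ⊜ y ⊕ t }) (x₀ ∷ t ∷ y ∷ [])))) pyt
        ... | true | false | true with () ← trans (sym (affine-at pyt px₀t px₀
              (solve 3 (λ { (x₀ ∷ t ∷ y ∷ []) → y ⊕ t ⊕ ⊝ (x₀ ⊕ t) ⊕ x₀ ⊜ y }) (x₀ ∷ t ∷ y ∷ [])))) py
        ... | false | true | true with () ← trans (sym (affine-at pyt py px₀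
              (solve 3 (λ { (x₀ ∷ t ∷ y ∷ []) → y ⊕ t ⊕ ⊝ y ⊕ x₀ ⊜ x₀ ⊕ t }) (x₀ ∷ t ∷ y ∷ [])))) px₀t
        ... | false | false | false with () ← trans (sym (affine-at
              (outside⇒shift-inside _ pyt) (outside⇒shift-inside _ px₀t) px₀
              (solve 4 (λ { (x₀ ∷ t ∷ y ∷ a ∷ []) → y ⊕ t ⊕ ⊝ a ⊕ ⊝ (x₀ ⊕ t ⊕ ⊝ a) ⊕ x₀ ⊜ y })
                (x₀ ∷ t ∷ y ∷ a ∷ [])))) py

        count+count≡r : count P + count P ≡ r
        count+count≡r = trans (sym count-∨-shift) (count-true cover)

  module TwoAffineSets {X Z : Fin r → Bool} (X-affine : IsAffine X) (Z-affine : IsAffine Z)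
                       {a b : Fin r} (X-disjoint : DisjointFromShift X a) (Z-disjoint : DisjointFromShift Z b)
                       (ε-agree : X ε ≡ Z ε) where

    V N I : ℕ
    V = count (λ x → X x ∨ Z x)
    N = count (λ x → not (X x) ∧ not (Z x))
    I = count (λ x → X x ∧ Z x)

    V+N≡r : V + N ≡ r
    V+N≡r = trans (cong (V +_) (count-cong λ x → sym (de-morgan (X x) (Z x)))) (count-complement _)
      where
      de-morgan : ∀ x z → not (x ∨ z) ≡ not x ∧ not z
      de-morgan true z = refl
      de-morgan false z = refl

    V+I≡X+Z : V + I ≡ count X + count Z
    V+I≡X+Z = count-inclusion-exclusion X Z

    small-union : ∀ {x z} → V + I ≡ x + z → 3 * x ≤ r → z + z ≤ r → r ≤ 6 * N
    small-union {x} {z} V+I≡ 3x≤r 2z≤r = +-cancelˡ-≤ (5 * r) r (6 * N) (begin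
      5 * r + r                ≡⟨ ℕ-solve 1 (λ r → con 5 :* r :+ r := con 6 :* r) refl r ⟩
      6 * r                    ≡⟨ cong (6 *_) (sym V+N≡r) ⟩
      6 * (V + N)              ≡⟨ *-distribˡ-+ 6 V N ⟩
      6 * V + 6 * N            ≤⟨ +-monoˡ-≤ (6 * N) (*-monoʳ-≤ 6 (m≤m+n V I)) ⟩
      6 * (V + I) + 6 * N      ≡⟨ cong (λ s → 6 * s + 6 * N) V+I≡ ⟩
      6 * (x + z) + 6 * N      ≡⟨ cong (_+ 6 * N) (ℕ-solve 2 (λ x z → con 6 :* (x :+ z)
                                    := con 2 :* (con 3 :* x) :+ con 3 :* (z :+ z)) refl x z) ⟩
      2 * (3 * x) + 3 * (z + z) + 6 * N  ≤⟨ +-monoˡ-≤ (6 * N) (+-mono-≤ (*-monoʳ-≤ 2 3x≤r) (*-monoʳ-≤ 3 2z≤r)) ⟩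
      2 * r + 3 * r + 6 * N    ≡⟨ cong (_+ 6 * N) (ℕ-solve 1 (λ r → con 2 :* r :+ con 3 :* r := con 5 :* r) refl r) ⟩
      5 * r + 6 * N            ∎)
      where
      open ≤-Reasoning
      open +-*-Solver using (_:=_; _:+_; _:*_; con) renaming (solve to ℕ-solve)

    module BothLarge (X-large : r < 3 * count X) (Z-large : r < 3 * count Z) where

      nonempty : ∀ {P : Fin r → Bool} → r < 3 * count P → ∃ λ x → P x ≡ true
      nonempty {P} large = count-nonzero⇒∃ P (*-cancelˡ-< 3 0 (count P) (≤-<-trans z≤n large))

      x₀ = proj₁ (nonempty X-large)
      z₀ = proj₁ (nonempty Z-large)
      x₀∈X = proj₂ (nonempty X-large)
      z₀∈Z = proj₂ (nonempty Z-large)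

      X-cover = covers X-disjoint X-affine x₀∈X X-large
      Z-cover = covers Z-disjoint Z-affine z₀∈Z Z-large

      X-law : ∀ t y → X (y ∙ t) ≡ (if X (x₀ ∙ t) then X y else not (X y))
      X-law = shift-law X-disjoint X-affine x₀∈X X-cover

      Z-law : ∀ t y → Z (y ∙ t) ≡ (if Z (z₀ ∙ t) then Z y else not (Z y))
      Z-law = shift-law Z-disjoint Z-affine z₀∈Z Z-cover

      X+X≡r : count X + count X ≡ r
      X+X≡r = count+count≡r X-disjoint X-affine x₀∈X X-cover

      Z+Z≡r : count Z + count Z ≡ r
      Z+Z≡r = count+count≡r Z-disjoint Z-affine z₀∈Z Z-cover

      N≡I : N ≡ I
      N≡I = +-cancelˡ-≡ V N I (trans V+N≡r (trans (sym X+Z≡r) (sym V+I≡X+Z)))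
        where
        X+Z≡r : count X + count Z ≡ r
        X+Z≡r = *-cancelˡ-≡ _ _ 2 (trans (interchange′ (count X) (count Z)) (trans (cong₂ _+_ X+X≡r Z+Z≡r)
          (cong (r +_) (sym (+-identityʳ r)))))
          where
          interchange′ : ∀ x z → 2 * (x + z) ≡ (x + x) + (z + z)
          interchange′ x z = trans (cong ((x + z) +_) (+-identityʳ (x + z)))
            (CommutativeSemigroupProperties.interchange +-commutativeSemigroup x z x z)

      quadruple : ∀ i → (i + i) + (i + i) ≡ 4 * i
      quadruple i = trans (+-assoc i i (i + i)) (cong (λ s → i + (i + (i + s))) (sym (+-identityʳ i)))

      doubled-intersection : ∀ {P : Fin r → Bool} → count P + count P ≡ r → count P ≡ I + I → r ≤ 6 * I
      doubled-intersection {P} P+P≡r P≡I+I = begin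
        r                        ≡⟨ sym P+P≡r ⟩
        count P + count P        ≡⟨ cong₂ _+_ P≡I+I P≡I+I ⟩
        (I + I) + (I + I)        ≡⟨ quadruple I ⟩
        4 * I                    ≤⟨ *-monoˡ-≤ I {4} {6} (s≤s (s≤s (s≤s (s≤s z≤n)))) ⟩
        6 * I                    ∎
        where open ≤-Reasoning

      differing-shift : ∀ t → X (x₀ ∙ t) ≢ Z (z₀ ∙ t) → r ≤ 6 * I
      differing-shift t ne with X (x₀ ∙ t) in ex | Z (z₀ ∙ t) in ez
      ... | true | true = ⊥-elim (ne refl)
      ... | false | false = ⊥-elim (ne refl)
      ... | true | false = doubled-intersection X+X≡r (trans (sym (count-split X Z)) (cong (I +_) X∖Z≡I))
        where
        pointwise : ∀ y → (X (y ∙ t) ∧ Z (y ∙ t)) ≡ (X y ∧ not (Z y))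
        pointwise y rewrite X-law t y | Z-law t y | ex | ez = refl
        X∖Z≡I : count (λ y → X y ∧ not (Z y)) ≡ I
        X∖Z≡I = trans (count-cong (sym ∘ pointwise)) (count-shift (λ y → X y ∧ Z y) t)
      ... | false | true = doubled-intersection Z+Z≡r (trans (sym (count-split Z X)) (cong₂ _+_ Z∧X≡I Z∖X≡I))
        where
        pointwise : ∀ y → (X (y ∙ t) ∧ Z (y ∙ t)) ≡ (Z y ∧ not (X y))
        pointwise y rewrite X-law t y | Z-law t y | ex | ez = ∧-comm (not (X y)) (Z y)
        Z∖X≡I : count (λ y → Z y ∧ not (X y)) ≡ I
        Z∖X≡I = trans (count-cong (sym ∘ pointwise)) (count-shift (λ y → X y ∧ Z y) t)
        Z∧X≡I : count (λ y → Z y ∧ X y) ≡ I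
        Z∧X≡I = count-cong λ y → ∧-comm (Z y) (X y)

      equal-shifts : (∀ t → X (x₀ ∙ t) ≡ Z (z₀ ∙ t)) → r ≤ 6 * I
      equal-shifts same = decide (X z₀) X≗
        where
        xnor-comm : ∀ a b → (if a then b else not b) ≡ (if b then a else not a)
        xnor-comm true true = refl
        xnor-comm true false = refl
        xnor-comm false true = refl
        xnor-comm false false = refl

        X≗ : ∀ y → X y ≡ (if X z₀ then Z y else not (Z y))
        X≗ y = begin
          X y                                         ≡⟨ cong X y≡ ⟩
          X (z₀ ∙ s)                                  ≡⟨ X-law s z₀ ⟩
          (if X (x₀ ∙ s) then X z₀ else not (X z₀))   ≡⟨ cong (λ b → if b then X z₀ else not (X z₀))
                                                           (trans (same s) (cong Z (sym y≡))) ⟩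
          (if Z y then X z₀ else not (X z₀))          ≡⟨ xnor-comm (Z y) (X z₀) ⟩
          (if X z₀ then Z y else not (Z y))           ∎
          where
          open ≡-Reasoning
          s = z₀ ⁻¹ ∙ y
          y≡ : y ≡ z₀ ∙ s
          y≡ = solve 2 (λ { (y ∷ z₀ ∷ []) → y ⊜ z₀ ⊕ (⊝ z₀ ⊕ y) }) (y ∷ z₀ ∷ [])

        decide : ∀ b → (∀ y → X y ≡ (if b then Z y else not (Z y))) → r ≤ 6 * I
        decide false X≗¬Z = ⊥-elim (not-¬ ε-agree (X≗¬Z ε))
        decide true X≗Z = begin
          r                    ≡⟨ sym X+X≡r ⟩
          count X + count X    ≡⟨ cong₂ _+_ X≡I X≡I ⟩
          I + I                ≡⟨ cong (I +_) (sym (+-identityʳ I)) ⟩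
          2 * I                ≤⟨ *-monoˡ-≤ I {2} {6} (s≤s (s≤s z≤n)) ⟩
          6 * I                ∎
          where
          open ≤-Reasoning
          X≡I : count X ≡ I
          X≡I = count-cong λ y → sym (trans (cong (X y ∧_) (sym (X≗Z y))) (∧-idem (X y)))

      intersection-large : r ≤ 6 * I
      intersection-large with all? (λ t → X (x₀ ∙ t) ≟ᵇ Z (z₀ ∙ t))
      ... | yes same = equal-shifts same
      ... | no differ = let t , ne = ¬∀⟶∃¬ r _ (λ t → X (x₀ ∙ t) ≟ᵇ Z (z₀ ∙ t)) differ in differing-shift t ne

    -- If X or Z has at most r/3 elements then |X ∪ Z| ≤ r/3 + r/2. Otherwise both are index-2 cosets,
    -- the complement of X ∪ Z is as large as X ∩ Z, and X ∩ Z has r/4 or r/2 elements: X = ∁Z is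
    -- impossible because ε ∈ X ⇔ ε ∈ Z.
    many-outside : r ≤ 6 * N
    many-outside with r <? 3 * count X | r <? 3 * count Z
    ... | no X-small | _ = small-union {count X} {count Z} V+I≡X+Z (≮⇒≥ X-small) (count+count≤r Z-disjoint)
    ... | yes _ | no Z-small = small-union {count Z} {count X} (trans V+I≡X+Z (+-comm (count X) (count Z))) (≮⇒≥ Z-small)
                                 (count+count≤r X-disjoint)
    ... | yes X-large | yes Z-large = subst (λ m → r ≤ 6 * m) (sym N≡I) intersection-large
      where open BothLarge X-large Z-large

module InversePairs {r : ℕ} (G : FinAbGroup r) where

  open FinAbGroupProperties G
  open Counting

  isRep? : ∀ x → Dec (toℕ x ≤ toℕ (x ⁻¹))
  isRep? x = toℕ x ≤? toℕ (x ⁻¹)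

  isRep : Fin r → Bool
  isRep x = does (isRep? x)

  rep : Fin r → Fin r
  rep x = if isRep x then x else x ⁻¹

  rep≡ : ∀ x {b} → isRep x ≡ b → rep x ≡ (if b then x else x ⁻¹)
  rep≡ x = cong (λ b → if b then x else x ⁻¹)

  isRep-⁻¹ : ∀ x → isRep x ≡ false → isRep (x ⁻¹) ≡ true
  isRep-⁻¹ x ¬rx = dec-true (isRep? (x ⁻¹)) (subst (λ y → toℕ (x ⁻¹) ≤ toℕ y) (sym (⁻¹-involutive x))
    (<⇒≤ (≰⇒> (does-false⇒ (isRep? x) ¬rx))))

  isRep-rep : ∀ x → isRep (rep x) ≡ true
  isRep-rep x = by-cases (isRep x) refl
    where
    by-cases : ∀ b → isRep x ≡ b → isRep (rep x) ≡ true
    by-cases true rx = trans (cong isRep (rep≡ x rx)) rx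
    by-cases false rx = trans (cong isRep (rep≡ x rx)) (isRep-⁻¹ x rx)

  rep-⁻¹ : ∀ x → rep (x ⁻¹) ≡ rep x
  rep-⁻¹ x = by-cases (isRep x) (isRep (x ⁻¹)) refl refl
    where
    by-cases : ∀ b c → isRep x ≡ b → isRep (x ⁻¹) ≡ c → rep (x ⁻¹) ≡ rep x
    by-cases true true rx rx⁻¹ = trans (rep≡ (x ⁻¹) rx⁻¹) (trans x⁻¹≡x (sym (rep≡ x rx)))
      where
      x⁻¹≡x : x ⁻¹ ≡ x
      x⁻¹≡x = toℕ-injective (≤-antisym
        (subst (λ y → toℕ (x ⁻¹) ≤ toℕ y) (⁻¹-involutive x) (does-true⇒ (isRep? (x ⁻¹)) rx⁻¹))
        (does-true⇒ (isRep? x) rx))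
    by-cases true false rx rx⁻¹ = trans (rep≡ (x ⁻¹) rx⁻¹) (trans (⁻¹-involutive x) (sym (rep≡ x rx)))
    by-cases false true rx rx⁻¹ = trans (rep≡ (x ⁻¹) rx⁻¹) (sym (rep≡ x rx))
    by-cases false false rx rx⁻¹ with () ← trans (sym (isRep-⁻¹ x rx)) rx⁻¹

  rep-cases : ∀ x → rep x ≡ x ⊎ rep x ≡ x ⁻¹
  rep-cases x = by-cases (isRep x) refl
    where
    by-cases : ∀ b → isRep x ≡ b → rep x ≡ x ⊎ rep x ≡ x ⁻¹
    by-cases true rx = inj₁ (rep≡ x rx)
    by-cases false rx = inj₂ (rep≡ x rx)

  rep≡⇒ : ∀ {x z} → rep z ≡ x → z ≡ x ⊎ z ≡ x ⁻¹
  rep≡⇒ {x} {z} eq with rep-cases z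
  ... | inj₁ e = inj₁ (trans (sym e) eq)
  ... | inj₂ e = inj₂ (trans (sym (⁻¹-involutive z)) (cong _⁻¹ (trans (sym e) eq)))

  invariant-choice : ∀ {s : Fin r → Bool} → (∀ x → s (x ⁻¹) ≡ s x) → ∀ b x → s (if b then x else x ⁻¹) ≡ s x
  invariant-choice s-⁻¹ true x = refl
  invariant-choice s-⁻¹ false x = s-⁻¹ x

  #reps : ℕ
  #reps = count isRep

  r≤2#reps : r ≤ #reps + #reps
  r≤2#reps = begin
    r                                                        ≡⟨ sym (count-true covered) ⟩
    count (λ x → isRep x ∨ isRep (x ⁻¹))                     ≤⟨ m≤m+n _ _ ⟩
    count (λ x → isRep x ∨ isRep (x ⁻¹)) + count (λ x → isRep x ∧ isRep (x ⁻¹))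
                                                             ≡⟨ count-inclusion-exclusion isRep (isRep ∘ _⁻¹) ⟩
    #reps + count (isRep ∘ _⁻¹)                              ≡⟨ cong (#reps +_) (count-permute isRep inversion) ⟩
    #reps + #reps                                            ∎
    where
    open ≤-Reasoning
    covered : ∀ x → (isRep x ∨ isRep (x ⁻¹)) ≡ true
    covered x with isRep x in rx
    ... | true = refl
    ... | false = isRep-⁻¹ x rx

  inverseClosedFromReps : Vec Bool #reps → Subset r
  inverseClosedFromReps v = tabulate (λ y → extend isRep false v (rep y))

  inverseClosedFromReps-inverseClosed : ∀ v → InverseClosed G (inverseClosedFromReps v)
  inverseClosedFromReps-inverseClosed v x x∈ = lookup⇒[]= (x ⁻¹) _ (begin
    lookup (inverseClosedFromReps v) (x ⁻¹)  ≡⟨ lookup∘tabulate _ (x ⁻¹) ⟩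
    extend isRep false v (rep (x ⁻¹))        ≡⟨ cong (extend isRep false v) (rep-⁻¹ x) ⟩
    extend isRep false v (rep x)             ≡⟨ sym (lookup∘tabulate _ x) ⟩
    lookup (inverseClosedFromReps v) x       ≡⟨ []=⇒lookup x∈ ⟩
    true                                     ∎)
    where open ≡-Reasoning

  restrict-inverseClosedFromReps : ∀ v → restrict isRep (lookup (inverseClosedFromReps v)) ≡ v
  restrict-inverseClosedFromReps v = restrict-extend isRep false v _ λ x rx →
    trans (lookup∘tabulate _ x) (cong (extend isRep false v) (rep≡ x rx))

  2^#reps≤n : ∀ {n} → HasCount (InverseClosed G) n → 2 ^ #reps ≤ n
  2^#reps≤n count-n = ≤-HasCount count-n (inverseClosedFromReps ∘ decode #reps)
    (inverseClosedFromReps-inverseClosed ∘ decode #reps)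
    λ eq → decode-injective #reps (trans (sym (restrict-inverseClosedFromReps _))
      (trans (cong (restrict isRep ∘ lookup) eq) (restrict-inverseClosedFromReps _)))
    where
    open Cardinality using (≤-HasCount)
    open Cardinality.VecCoding (↔-sym 2↔Bool)

  module Moves (β : Fin r → Fin r) where


    fixes inverts moves : Fin r → Bool
    fixes x = does (β x ≟ x)
    inverts x = does (β x ≟ x ⁻¹)
    moves x = does (¬? (β x ≟ x) ×-dec ¬? (β x ≟ x ⁻¹))

    fixes⇒ : ∀ {x} → fixes x ≡ true → β x ≡ x
    fixes⇒ {x} = does-true⇒ (β x ≟ x)

    inverts⇒ : ∀ {x} → inverts x ≡ true → β x ≡ x ⁻¹
    inverts⇒ {x} = does-true⇒ (β x ≟ x ⁻¹)

    moves⇒ : ∀ {x} → moves x ≡ true → β x ≢ x × β x ≢ x ⁻¹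
    moves⇒ {x} = does-true⇒ (¬? (β x ≟ x) ×-dec ¬? (β x ≟ x ⁻¹))

    movedOf : Fin r → Fin r
    movedOf x = if moves x then x else x ⁻¹

    active : Fin r → Bool
    active x = isRep x ∧ (moves x ∨ moves (x ⁻¹))

    next : Fin r → Fin r
    next x = rep (β (movedOf x))

    movedOf-moves : ∀ x → active x ≡ true → moves (movedOf x) ≡ true × (movedOf x ≡ x ⊎ movedOf x ≡ x ⁻¹)
    movedOf-moves x ax = by-cases (moves x) refl
      where
      movedOf≡ : ∀ {b} → moves x ≡ b → movedOf x ≡ (if b then x else x ⁻¹)
      movedOf≡ = cong (λ b → if b then x else x ⁻¹)
      by-cases : ∀ b → moves x ≡ b → moves (movedOf x) ≡ true × (movedOf x ≡ x ⊎ movedOf x ≡ x ⁻¹)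
      by-cases true mx = trans (cong moves (movedOf≡ mx)) mx , inj₁ (movedOf≡ mx)
      by-cases false mx = trans (cong moves (movedOf≡ mx)) (trans (cong (_∨ moves (x ⁻¹)) (sym mx)) (∧-conicalʳ _ _ ax)) ,
                          inj₂ (movedOf≡ mx)

    next≢ : ∀ x → active x ≡ true → next x ≢ x
    next≢ x ax next≡x with movedOf-moves x ax
    ... | my , y≡ with moves⇒ my | rep≡⇒ next≡x | y≡
    ... | β≢y , _ | inj₁ βy≡x | inj₁ y≡x = β≢y (trans βy≡x (sym y≡x))
    ... | _ , β≢y⁻¹ | inj₁ βy≡x | inj₂ y≡x⁻¹ =
      β≢y⁻¹ (trans βy≡x (trans (sym (⁻¹-involutive x)) (cong _⁻¹ (sym y≡x⁻¹))))
    ... | _ , β≢y⁻¹ | inj₂ βy≡x⁻¹ | inj₁ y≡x = β≢y⁻¹ (trans βy≡x⁻¹ (cong _⁻¹ (sym y≡x)))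
    ... | β≢y , _ | inj₂ βy≡x⁻¹ | inj₂ y≡x⁻¹ = β≢y (trans βy≡x⁻¹ (sym y≡x⁻¹))

    descending ascending : Fin r → Bool
    descending x = active x ∧ does (toℕ (next x) <? toℕ x)
    ascending x = active x ∧ does (toℕ x <? toℕ (next x))

    descending⇒ : ∀ {x} → descending x ≡ true → toℕ (next x) < toℕ x
    descending⇒ {x} dx = does-true⇒ (toℕ (next x) <? toℕ x) (∧-conicalʳ (active x) _ dx)

    ascending⇒ : ∀ {x} → ascending x ≡ true → toℕ x < toℕ (next x)
    ascending⇒ {x} ax = does-true⇒ (toℕ x <? toℕ (next x)) (∧-conicalʳ (active x) _ ax)

    count-descending+ascending : count descending + count ascending ≡ count active
    count-descending+ascending = begin
      count descending + count ascending
        ≡⟨ sym (count-inclusion-exclusion descending ascending) ⟩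
      count (λ x → descending x ∨ ascending x) + count (λ x → descending x ∧ ascending x)
        ≡⟨ cong₂ _+_ (count-cong union) (count-false disjoint) ⟩
      count active + 0
        ≡⟨ +-identityʳ _ ⟩
      count active ∎
      where
      open ≡-Reasoning
      union : ∀ x → (descending x ∨ ascending x) ≡ active x
      union x = by-cases (active x) (toℕ (next x) <? toℕ x) (toℕ x <? toℕ (next x)) refl
        where
        by-cases : ∀ a (d₁ : Dec (toℕ (next x) < toℕ x)) (d₂ : Dec (toℕ x < toℕ (next x))) → active x ≡ a →
          ((a ∧ does d₁) ∨ (a ∧ does d₂)) ≡ a
        by-cases false _ _ _ = refl
        by-cases true (yes _) _ _ = refl
        by-cases true (no _) (yes _) _ = refl
        by-cases true (no next≮x) (no x≮next) ax =
          ⊥-elim (next≢ x ax (toℕ-injective (≤-antisym (≮⇒≥ x≮next) (≮⇒≥ next≮x))))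
      disjoint : ∀ x → (descending x ∧ ascending x) ≡ false
      disjoint x = by-cases (active x) (toℕ (next x) <? toℕ x) (toℕ x <? toℕ (next x))
        where
        by-cases : ∀ a (d₁ : Dec (toℕ (next x) < toℕ x)) (d₂ : Dec (toℕ x < toℕ (next x))) →
          ((a ∧ does d₁) ∧ (a ∧ does d₂)) ≡ false
        by-cases false _ _ = refl
        by-cases true (yes next<x) (yes x<next) = ⊥-elim (<-asym next<x x<next)
        by-cases true (yes _) (no _) = refl
        by-cases true (no _) _ = refl

    useDescending : Bool
    useDescending = does (count ascending ≤? count descending)

    determined : Fin r → Bool
    determined x = if useDescending then descending x else ascending x

    determined≗ : ∀ {b} → useDescending ≡ b → ∀ x → determined x ≡ (if b then descending x else ascending x)
    determined≗ eq x = cong (λ b → if b then descending x else ascending x) eq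

    free : Fin r → Bool
    free x = isRep x ∧ not (determined x)

    determined⇒active : ∀ x → determined x ≡ true → active x ≡ true
    determined⇒active x dx = by-cases useDescending refl
      where
      by-cases : ∀ b → useDescending ≡ b → active x ≡ true
      by-cases true eq = ∧-conicalˡ _ _ (trans (sym (determined≗ eq x)) dx)
      by-cases false eq = ∧-conicalˡ _ _ (trans (sym (determined≗ eq x)) dx)

    count-active≤ : count active ≤ count determined + count determined
    count-active≤ with count ascending ≤? count descending in eq
    ... | yes asc≤desc = subst (λ c → count active ≤ c + c) (count-cong (sym ∘ determined≗ (cong does eq)))
      (subst (_≤ count descending + count descending) count-descending+ascending (+-monoʳ-≤ (count descending) asc≤desc))
    ... | no asc≰desc = subst (λ c → count active ≤ c + c) (count-cong (sym ∘ determined≗ (cong does eq)))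
      (subst (_≤ count ascending + count ascending) count-descending+ascending
        (+-monoˡ-≤ (count ascending) (<⇒≤ (≰⇒> asc≰desc))))

    count-moves≤ : count moves ≤ count active + count active
    count-moves≤ = begin
      count moves                                                       ≤⟨ count-mono moves⇒active ⟩
      count (λ x → active x ∨ active (x ⁻¹))                            ≤⟨ m≤m+n _ _ ⟩
      count (λ x → active x ∨ active (x ⁻¹)) + count (λ x → active x ∧ active (x ⁻¹))
                                                                        ≡⟨ count-inclusion-exclusion active (active ∘ _⁻¹) ⟩
      count active + count (active ∘ _⁻¹)
                                                                        ≡⟨ cong (count active +_) (count-permute active inversion) ⟩
      count active + count active                                       ∎
      where
      open ≤-Reasoning
      moves⇒active : ∀ x → moves x ≡ true →
        ((isRep x ∧ (moves x ∨ moves (x ⁻¹))) ∨ (isRep (x ⁻¹) ∧ (moves (x ⁻¹) ∨ moves (x ⁻¹ ⁻¹)))) ≡ true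
      moves⇒active x mx with isRep x in rx
      ... | true rewrite mx = refl
      ... | false rewrite isRep-⁻¹ x rx | ⁻¹-involutive x | mx = ∨-zeroʳ _

    count-free+count-determined : count free + count determined ≡ #reps
    count-free+count-determined = trans (+-comm (count free) (count determined))
      (trans (cong (_+ count free) (sym (count-cong isRep∧determined))) (count-split isRep determined))
      where
      isRep∧determined : ∀ x → (isRep x ∧ determined x) ≡ determined x
      isRep∧determined x with determined x in dx
      ... | true = trans (∧-identityʳ (isRep x)) (∧-conicalˡ _ _ (determined⇒active x dx))
      ... | false = ∧-zeroʳ _

    r≤24#determined : r ≤ 6 * count moves → r ≤ 24 * count determined
    r≤24#determined r≤6moves = begin
      r                                           ≤⟨ r≤6moves ⟩
      6 * count moves
        ≤⟨ *-monoʳ-≤ 6 (≤-trans count-moves≤ (+-mono-≤ count-active≤ count-active≤)) ⟩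
      6 * ((count determined + count determined) + (count determined + count determined))
        ≡⟨ ℕ-solve 1 (λ d → con 6 :* ((d :+ d) :+ (d :+ d)) := con 24 :* d) refl (count determined) ⟩
      24 * count determined                       ∎
      where
      open ≤-Reasoning
      open +-*-Solver using (_:=_; _:+_; _:*_; con) renaming (solve to ℕ-solve)

    height : Bool → Fin r → ℕ
    height true x = toℕ x
    height false x = r ∸ toℕ x

    height-next : ∀ x → determined x ≡ true → height useDescending (next x) < height useDescending x
    height-next x dx = by-cases useDescending refl
      where
      by-cases : ∀ b → useDescending ≡ b → height useDescending (next x) < height useDescending x
      by-cases true eq = subst (λ b → height b (next x) < height b x) (sym eq)
        (descending⇒ (trans (sym (determined≗ eq x)) dx))
      by-cases false eq = subst (λ b → height b (next x) < height b x) (sym eq)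
        (∸-monoʳ-< (ascending⇒ (trans (sym (determined≗ eq x)) dx)) (<⇒≤ (toℕ<n (next x))))

    Invariant : (Fin r → Bool) → Set
    Invariant s = (∀ x → s (x ⁻¹) ≡ s x) × (∀ x → s (β x) ≡ s x)

    s-next : ∀ {s} → Invariant s → ∀ x → s (next x) ≡ s x
    s-next (s-⁻¹ , s-β) x =
      trans (invariant-choice s-⁻¹ (isRep (β (movedOf x))) (β (movedOf x)))
        (trans (s-β (movedOf x)) (invariant-choice s-⁻¹ (moves x) x))

    -- Each determined representative x shares its value with the representative next x, which is
    -- strictly lower in height; so the values on the free representatives propagate to all of them.
    determined-by-free : ∀ {s₁ s₂} → Invariant s₁ → Invariant s₂ →
      (∀ x → free x ≡ true → s₁ x ≡ s₂ x) → ∀ x → s₁ x ≡ s₂ x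
    determined-by-free {s₁} {s₂} inv₁@(s₁-⁻¹ , _) inv₂@(s₂-⁻¹ , _) agree x = begin
      s₁ x          ≡⟨ sym (invariant-choice s₁-⁻¹ (isRep x) x) ⟩
      s₁ (rep x)    ≡⟨ on-reps (rep x) (<-wellFounded _) (isRep-rep x) ⟩
      s₂ (rep x)    ≡⟨ invariant-choice s₂-⁻¹ (isRep x) x ⟩
      s₂ x          ∎
      where
      open ≡-Reasoning
      on-reps : ∀ y → Acc _<_ (height useDescending y) → isRep y ≡ true → s₁ y ≡ s₂ y
      on-reps y (acc smaller) ry with determined y in dy
      ... | false = agree y (cong₂ (λ a b → a ∧ not b) ry dy)
      ... | true = trans (sym (s-next inv₁ y))
        (trans (on-reps (next y) (smaller (height-next y dy)) (isRep-rep (β (movedOf y)))) (s-next inv₂ y))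

module Holomorph {r : ℕ} (G : FinAbGroup r) where

  open FinAbGroupProperties G
  open Counting
  open AffineSubsets G
  open InversePairs G

  module AffineMap {β ψ : Fin r → Fin r} {a₀ : Fin r} (ψ-hom : IsHomomorphism ψ) (β≗ : ∀ x → β x ≡ ψ x ∙ a₀) where

    open Homomorphism ψ-hom
    open Moves β

    β-shift : ∀ x g → β (x ∙ g) ≡ β x ∙ ψ g
    β-shift x g = begin
      β (x ∙ g)              ≡⟨ β≗ (x ∙ g) ⟩
      ψ (x ∙ g) ∙ a₀         ≡⟨ cong (_∙ a₀) (ψ-hom x g) ⟩
      ψ x ∙ ψ g ∙ a₀         ≡⟨ solve 3 (λ { (p ∷ q ∷ a ∷ []) → p ⊕ q ⊕ a ⊜ p ⊕ a ⊕ q })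
                                  (ψ x ∷ ψ g ∷ a₀ ∷ []) ⟩
      ψ x ∙ a₀ ∙ ψ g         ≡⟨ cong (_∙ ψ g) (sym (β≗ x)) ⟩
      β x ∙ ψ g              ∎
      where open ≡-Reasoning

    β-affine : ∀ x y z → β (x ∙ y ⁻¹ ∙ z) ≡ β x ∙ β y ⁻¹ ∙ β z
    β-affine x y z = begin
      β (x ∙ y ⁻¹ ∙ z)                      ≡⟨ β-shift _ z ⟩
      β (x ∙ y ⁻¹) ∙ ψ z                    ≡⟨ cong (_∙ ψ z) (β-shift x (y ⁻¹)) ⟩
      β x ∙ ψ (y ⁻¹) ∙ ψ z                  ≡⟨ cong (λ w → β x ∙ w ∙ ψ z) (ψ-⁻¹ y) ⟩
      β x ∙ ψ y ⁻¹ ∙ ψ z                    ≡⟨ cong₂ (λ u v → β x ∙ u ⁻¹ ∙ v) (ψ≗ y) (ψ≗ z) ⟩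
      β x ∙ (β y ∙ a₀ ⁻¹) ⁻¹ ∙ (β z ∙ a₀ ⁻¹) ≡⟨ solve 4 (λ { (p ∷ q ∷ t ∷ a ∷ []) →
                                                   p ⊕ ⊝ (q ⊕ ⊝ a) ⊕ (t ⊕ ⊝ a) ⊜ p ⊕ ⊝ q ⊕ t })
                                                  (β x ∷ β y ∷ β z ∷ a₀ ∷ []) ⟩
      β x ∙ β y ⁻¹ ∙ β z                    ∎
      where
      open ≡-Reasoning
      ψ≗ : ∀ w → ψ w ≡ β w ∙ a₀ ⁻¹
      ψ≗ w = trans (solve 2 (λ { (p ∷ a ∷ []) → p ⊜ p ⊕ a ⊕ ⊝ a }) (ψ w ∷ a₀ ∷ []))
                   (cong (_∙ a₀ ⁻¹) (sym (β≗ w)))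

    fixes-affine : IsAffine fixes
    fixes-affine x y z fx fy fz = dec-true (_ ≟ _) (trans (β-affine x y z)
      (cong₂ _∙_ (cong₂ (λ u v → u ∙ v ⁻¹) (fixes⇒ fx) (fixes⇒ fy)) (fixes⇒ fz)))

    inverts-affine : IsAffine inverts
    inverts-affine x y z ix iy iz = dec-true (_ ≟ _) (trans (β-affine x y z) (trans
      (cong₂ _∙_ (cong₂ (λ u v → u ∙ v ⁻¹) (inverts⇒ ix) (inverts⇒ iy)) (inverts⇒ iz))
      (solve 3 (λ { (x ∷ y ∷ z ∷ []) → ⊝ x ⊕ ⊝ (⊝ y) ⊕ ⊝ z ⊜ ⊝ (x ⊕ ⊝ y ⊕ z) }) (x ∷ y ∷ z ∷ []))))

    fixes-disjoint : ∀ {a} → ψ a ≢ a → DisjointFromShift fixes a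
    fixes-disjoint {a} ψa≢a x fx = dec-false (_ ≟ _) λ βxa≡xa →
      ψa≢a (∙-cancelˡ x _ _ (trans (sym (trans (β-shift x a) (cong (_∙ ψ a) (fixes⇒ fx)))) βxa≡xa))

    inverts-disjoint : ∀ {b} → ψ b ≢ b ⁻¹ → DisjointFromShift inverts b
    inverts-disjoint {b} ψb≢b⁻¹ x ix = dec-false (_ ≟ _) λ βxb≡xb⁻¹ →
      ψb≢b⁻¹ (∙-cancelˡ (x ⁻¹) _ _ (trans (sym (trans (β-shift x b) (cong (_∙ ψ b) (inverts⇒ ix))))
        (trans βxb≡xb⁻¹ (⁻¹-distrib-∙ x b))))

    many-moved : (∃ λ a → ψ a ≢ a) → (∃ λ b → ψ b ≢ b ⁻¹) → r ≤ 6 * count moves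
    many-moved (a , ψa≢a) (b , ψb≢b⁻¹) =
      TwoAffineSets.many-outside fixes-affine inverts-affine (fixes-disjoint ψa≢a) (inverts-disjoint ψb≢b⁻¹)
        (cong (λ y → does (β ε ≟ y)) (sym ε⁻¹≈ε))

  module HolomorphElement (α : Permutation′ r) (α-hol : InHol G α) where

    α⟨_⟩ : Fin r → Fin r
    α⟨ x ⟩ = α ⟨$⟩ʳ x

    a₀ : Fin r
    a₀ = α⟨ ε ⟩

    ψ : Fin r → Fin r
    ψ x = α⟨ x ⟩ ∙ a₀ ⁻¹

    α≗ : ∀ x → α⟨ x ⟩ ≡ ψ x ∙ a₀
    α≗ x = solve 2 (λ { (y ∷ a ∷ []) → y ⊜ y ⊕ ⊝ a ⊕ a }) (α⟨ x ⟩ ∷ a₀ ∷ [])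

    -- α R(g) α⁻¹ = R(h) for some h, which evaluating at ε identifies as ψ g.
    α-shift : ∀ y g → α⟨ y ∙ g ⟩ ≡ α⟨ y ⟩ ∙ ψ g
    α-shift y g = trans (conjugate y) (cong (α⟨ y ⟩ ∙_) h≡ψg)
      where
      h = proj₁ (proj₁ α-hol g)
      conjugate : ∀ y → α⟨ y ∙ g ⟩ ≡ α⟨ y ⟩ ∙ h
      conjugate y = trans (cong (λ z → α⟨ z ∙ g ⟩) (sym (Permutation.inverseˡ α))) (proj₂ (proj₁ α-hol g) (α⟨ y ⟩))
      h≡ψg : h ≡ ψ g
      h≡ψg = begin
        h                        ≡⟨ solve 2 (λ { (h ∷ a ∷ []) → h ⊜ a ⊕ h ⊕ ⊝ a }) (h ∷ a₀ ∷ []) ⟩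
        a₀ ∙ h ∙ a₀ ⁻¹           ≡⟨ cong (_∙ a₀ ⁻¹) (sym (conjugate ε)) ⟩
        α⟨ ε ∙ g ⟩ ∙ a₀ ⁻¹   ≡⟨ cong (λ z → α⟨ z ⟩ ∙ a₀ ⁻¹) (identityˡ g) ⟩
        ψ g                      ∎
        where open ≡-Reasoning

    ψ-hom : IsHomomorphism ψ
    ψ-hom x y = trans (cong (_∙ a₀ ⁻¹) (α-shift x y))
      (solve 3 (λ { (p ∷ q ∷ a ∷ []) → p ⊕ q ⊕ ⊝ a ⊜ p ⊕ ⊝ a ⊕ q }) (α⟨ x ⟩ ∷ ψ y ∷ a₀ ∷ []))

  module SymmetricSet (S : Subset r) (S-closed : InverseClosed G S) (S-twinFree : TwinFree G S)
                      (α : Permutation′ r) (α-hol : InHol G α) (α-nontrivial : NotIdOrInv G α)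
                      (α-fixes : Fixes G α S) where

    open HolomorphElement α α-hol public

    s : Fin r → Bool
    s = lookup S

    lookup-cong : ∀ {x y} → (x ∈ S → y ∈ S) → (y ∈ S → x ∈ S) → s x ≡ s y
    lookup-cong x⇒y y⇒x = ⇔→≡ (mk⇔ ([]=⇒lookup ∘ x⇒y ∘ lookup⇒[]= _ S) ([]=⇒lookup ∘ y⇒x ∘ lookup⇒[]= _ S))

    ∈-cong : ∀ {x y} → s x ≡ s y → x ∈ S ⇔ y ∈ S
    ∈-cong eq = mk⇔ (λ x∈ → lookup⇒[]= _ S (trans (sym eq) ([]=⇒lookup x∈)))
                    (λ y∈ → lookup⇒[]= _ S (trans eq ([]=⇒lookup y∈)))

    s-⁻¹ : ∀ x → s (x ⁻¹) ≡ s x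
    s-⁻¹ x = lookup-cong (subst (_∈ S) (⁻¹-involutive x) ∘ S-closed (x ⁻¹)) (S-closed x)

    s-α : ∀ x → s α⟨ x ⟩ ≡ s x
    s-α x = lookup-cong preimage (λ x∈ → Equivalence.to (α-fixes _) (x , x∈ , refl))
      where
      preimage : α⟨ x ⟩ ∈ S → x ∈ S
      preimage αx∈ with Equivalence.from (α-fixes _) αx∈
      ... | y , y∈ , αy≡αx = subst (_∈ S)
        (trans (sym (Permutation.inverseˡ α)) (trans (cong (α ⟨$⟩ˡ_) αy≡αx) (Permutation.inverseˡ α))) y∈

    translation-invariant⇒trivial : ∀ a → (∀ z → s z ≡ s (z ∙ a ⁻¹)) → ε ≡ a
    translation-invariant⇒trivial a invariant = S-twinFree ε a λ z →
      ∈-cong (trans (cong s (solve 1 (λ { (z ∷ []) → z ⊕ ⊝ unit ⊜ z }) (z ∷ []))) (invariant z))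

    ψ≢id : ¬ (∀ x → ψ x ≡ x)
    ψ≢id ψ≗id = proj₁ α-nontrivial λ x → trans (α≗ x) (trans (cong₂ _∙_ (ψ≗id x) (sym ε≡a₀)) (identityʳ x))
      where
      ε≡a₀ : ε ≡ a₀
      ε≡a₀ = translation-invariant⇒trivial a₀ λ z → trans (cong s (sym (begin
        α⟨ z ∙ a₀ ⁻¹ ⟩        ≡⟨ α≗ _ ⟩
        ψ (z ∙ a₀ ⁻¹) ∙ a₀        ≡⟨ cong (_∙ a₀) (ψ≗id _) ⟩
        z ∙ a₀ ⁻¹ ∙ a₀            ≡⟨ solve 2 (λ { (z ∷ a ∷ []) → z ⊕ ⊝ a ⊕ a ⊜ z }) (z ∷ a₀ ∷ []) ⟩
        z                         ∎))) (s-α _)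
        where open ≡-Reasoning

    ψ≢⁻¹ : ¬ (∀ x → ψ x ≡ x ⁻¹)
    ψ≢⁻¹ ψ≗⁻¹ = proj₂ α-nontrivial λ x →
      trans (α≗ x) (trans (cong₂ _∙_ (ψ≗⁻¹ x) (sym ε≡a₀)) (identityʳ _))
      where
      ε≡a₀ : ε ≡ a₀
      ε≡a₀ = translation-invariant⇒trivial a₀ λ z → let w = (z ∙ a₀ ⁻¹) ⁻¹ in begin
        s z                       ≡⟨ cong s (sym (begin
          α⟨ w ⟩                  ≡⟨ α≗ w ⟩
          ψ w ∙ a₀                  ≡⟨ cong (_∙ a₀) (ψ≗⁻¹ w) ⟩
          w ⁻¹ ∙ a₀                 ≡⟨ solve 2 (λ { (z ∷ a ∷ []) → ⊝ ⊝ (z ⊕ ⊝ a) ⊕ a ⊜ z })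
                                         (z ∷ a₀ ∷ []) ⟩
          z                         ∎)) ⟩
        s (α⟨ w ⟩)              ≡⟨ s-α w ⟩
        s w                       ≡⟨ s-⁻¹ _ ⟩
        s (z ∙ a₀ ⁻¹)             ∎
        where open ≡-Reasoning

    ψ-not-identity-at : ∃ λ a → ψ a ≢ a
    ψ-not-identity-at = ¬∀⟶∃¬ r _ (λ a → ψ a ≟ a) ψ≢id

    ψ-not-inversion-at : ∃ λ b → ψ b ≢ b ⁻¹
    ψ-not-inversion-at = ¬∀⟶∃¬ r _ (λ b → ψ b ≟ b ⁻¹) ψ≢⁻¹

module EncodingS₃′ {r : ℕ} (G : FinAbGroup r) (e′ : ℕ) (pow-exponent : ∀ g → pow G g (suc e′) ≡ FinAbGroup.ε G) where

  open FinAbGroupProperties G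
  open Counting
  open Arithmetic using (⌈_/24⌉; m≤24*⌈m/24⌉; ⌈m/24⌉-least)
  open InversePairs G
  open Holomorph G
  open Generators G e′ pow-exponent
  open Cardinality using (HasCount-≤; pad; pad-injective)

  M : ℕ
  M = #reps ∸ ⌈ r /24⌉

  ⌈r/24⌉≤#reps : ⌈ r /24⌉ ≤ #reps
  ⌈r/24⌉≤#reps = ⌈m/24⌉-least {r} {#reps} (≤-trans r≤2#reps
    (≤-trans (≤-reflexive (cong (#reps +_) (sym (+-identityʳ #reps)))) (*-monoˡ-≤ #reps {2} {24} (s≤s (s≤s z≤n)))))

  24M+r≤24#reps : 24 * M + r ≤ 24 * #reps
  24M+r≤24#reps = begin
    24 * M + r                   ≤⟨ +-monoʳ-≤ (24 * M) (m≤24*⌈m/24⌉ r) ⟩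
    24 * M + 24 * ⌈ r /24⌉       ≡⟨ sym (*-distribˡ-+ 24 M ⌈ r /24⌉) ⟩
    24 * (M + ⌈ r /24⌉)          ≡⟨ cong (24 *_) (m∸n+n≡m ⌈r/24⌉≤#reps) ⟩
    24 * #reps                   ∎
    where open ≤-Reasoning

  affineMap : Fin r → Vec (Fin r) #gens → Fin r → Fin r
  affineMap a hs x = homomorphismFromImages hs x ∙ a

  #free≤M : ∀ {a hs} → r ≤ 6 * count (Moves.moves (affineMap a hs)) → count (Moves.free (affineMap a hs)) ≤ M
  #free≤M {a} {hs} many = begin
    count free                                   ≡⟨ sym (m+n∸n≡m (count free) (count determined)) ⟩
    count free + count determined ∸ count determined ≡⟨ cong (_∸ count determined) count-free+count-determined ⟩
    #reps ∸ count determined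
      ≤⟨ ∸-monoʳ-≤ #reps (⌈m/24⌉-least {r} {count determined} (r≤24#determined many)) ⟩
    #reps ∸ ⌈ r /24⌉                             ∎
    where
    open ≤-Reasoning
    open Moves (affineMap a hs)

  Code : Set
  Code = Fin r × Vec (Fin r) #gens × Vec Bool M

  module FinVec = Cardinality.VecCoding (↔-refl {A = Fin r})
  module BoolVec = Cardinality.VecCoding (↔-sym 2↔Bool)

  encodeCode : Code → Fin (r * (r ^ #gens * 2 ^ M))
  encodeCode (a , hs , bits) = combine a (combine (FinVec.encode hs) (BoolVec.encode bits))

  encodeCode-injective : ∀ {c c′} → encodeCode c ≡ encodeCode c′ → c ≡ c′
  encodeCode-injective {a , hs , bits} {a′ , hs′ , bits′} eq
    with a≡a′ , rest ← combine-injective a _ a′ _ eq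
    with hs≡ , bits≡ ← combine-injective (FinVec.encode hs) _ (FinVec.encode hs′) _ rest
    = cong₂ _,_ a≡a′ (cong₂ _,_ (FinVec.encode-injective hs≡) (BoolVec.encode-injective bits≡))

  bitsOf : Fin r → Vec (Fin r) #gens → Subset r → Vec Bool M
  bitsOf a hs S = pad M false (restrict (Moves.free (affineMap a hs)) (lookup S))

  bits-determine : ∀ {a hs} {S S′ : Subset r} → Moves.Invariant (affineMap a hs) (lookup S) →
    Moves.Invariant (affineMap a hs) (lookup S′) → count (Moves.free (affineMap a hs)) ≤ M →
    bitsOf a hs S ≡ bitsOf a hs S′ → S ≡ S′
  bits-determine {a} {hs} {S} {S′} inv inv′ #free≤M eq = begin
    S                     ≡⟨ sym (tabulate∘lookup S) ⟩
    tabulate (lookup S)   ≡⟨ tabulate-cong (determined-by-free inv inv′ agree) ⟩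
    tabulate (lookup S′)  ≡⟨ tabulate∘lookup S′ ⟩
    S′                    ∎
    where
    open ≡-Reasoning
    open Moves (affineMap a hs)
    agree : ∀ x → free x ≡ true → lookup S x ≡ lookup S′ x
    agree = restrict-injective free (pad-injective false #free≤M eq)

  module CodeOf (S : Subset r) (S-closed : InverseClosed G S) (S-twinFree : TwinFree G S)
                (α : Permutation′ r) (α-hol : InHol G α) (α-nontrivial : NotIdOrInv G α)
                (α-fixes : Fixes G α S) where

    open SymmetricSet S S-closed S-twinFree α α-hol α-nontrivial α-fixes public

    images : Vec (Fin r) #gens
    images = map ψ (fromList gens)

    β≗ : ∀ x → affineMap a₀ images x ≡ ψ x ∙ a₀
    β≗ x = cong (_∙ a₀) (homomorphismFromImages-correct ψ-hom x)

    invariant : Moves.Invariant (affineMap a₀ images) s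
    invariant = s-⁻¹ , λ x → trans (cong s (trans (β≗ x) (sym (α≗ x)))) (s-α x)

    #free≤M′ : count (Moves.free (affineMap a₀ images)) ≤ M
    #free≤M′ = #free≤M (AffineMap.many-moved ψ-hom β≗ ψ-not-identity-at ψ-not-inversion-at)

    code : Code
    code = a₀ , images , bitsOf a₀ images S

  code : ∀ S → InS₃′ G S → Code
  code S ((S-closed , _ , _ , S-twinFree) , α , α-hol , α-nontrivial , α-fixes) =
    CodeOf.code S S-closed S-twinFree α α-hol α-nontrivial α-fixes

  code-injective : ∀ {S S′} p p′ → code S p ≡ code S′ p′ → S ≡ S′
  code-injective {S} {S′} ((closed , _ , _ , twinFree) , α , hol , nontrivial , fixes)
                 ((closed′ , _ , _ , twinFree′) , α′ , hol′ , nontrivial′ , fixes′) eq =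
    same-map (cong proj₁ eq) (cong (proj₁ ∘ proj₂) eq) C.invariant C′.invariant C.#free≤M′ (cong (proj₂ ∘ proj₂) eq)
    where
    module C = CodeOf S closed twinFree α hol nontrivial fixes
    module C′ = CodeOf S′ closed′ twinFree′ α′ hol′ nontrivial′ fixes′
    same-map : ∀ {a a′ hs hs′} → a ≡ a′ → hs ≡ hs′ → Moves.Invariant (affineMap a hs) (lookup S) →
      Moves.Invariant (affineMap a′ hs′) (lookup S′) → count (Moves.free (affineMap a hs)) ≤ M →
      bitsOf a hs S ≡ bitsOf a′ hs′ S′ → S ≡ S′
    same-map refl refl = bits-determine

  n₃≤r*r^#gens*2^M : ∀ {n₃} → HasCount (InS₃′ G) n₃ → n₃ ≤ r * (r ^ #gens * 2 ^ M)
  n₃≤r*r^#gens*2^M count-n₃ =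
    HasCount-≤ count-n₃ (λ S p → encodeCode (code S p)) λ p p′ → code-injective p p′ ∘ encodeCode-injective

lemma3p7 : (r : ℕ) (G : FinAbGroup r) →
    (∃ λ e → IsExponent G e × 2 < e) →
    (n n₃ : ℕ) →
    HasCount (InverseClosed G) n →
    HasCount (InS₃′ G) n₃ →
    Bound r n n₃
lemma3p7 r G (suc e′ , (_ , pow-exponent , _) , _) n n₃ count-n count-n₃ =
  Bound-intro #gens M #reps (n₃≤r*r^#gens*2^M count-n₃) (2^#reps≤n count-n) 2^#gens≤r 24M+r≤24#reps
  where
  open Arithmetic using (Bound-intro)
  open InversePairs G using (#reps; 2^#reps≤n)
  open Generators G e′ pow-exponent using (#gens; 2^#gens≤r)
  open EncodingS₃′ G e′ pow-exponent using (M; n₃≤r*r^#gens*2^M; 24M+r≤24#reps)
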